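{- Let $m$ be a prime power (i.e., $m=p^n$ for some prime $p$ and integer $n\ge 0$), let $A=\{a_s(n_s)\}_{s=1}^k$ (with $a_s\in\mathbb Z$, $n_s\in\mathbb Z^+$) be an $m$-cover of $\mathbb Z$, and let $m_1,\ldots,m_k\in\mathbb Z$. Then there is a nonempty $I\subseteq\{1,\ldots,k\}$ with $\sum_{s\in I}m_s/n_s\in m\mathbb Z$; in particular there is $I\subseteq\{1,\ldots,k\}$ with $\sum_{s\in I}1/n_s\in m\mathbb Z^+$. Moreover, for any $J\subseteq\{1,\ldots,k\}$ there is $I\subseteq\{1,\ldots,k\}$ with $I\ne J$ and $\sum_{s\in I}m_s/n_s-\sum_{s\in J}m_s/n_s\in m\mathbb Z$.
   Context: For $a\in\mathbb Z$ and $n\in\mathbb Z^+$, $a(n)=a+n\mathbb Z$. For $A=\{a_s(n_s)\}_{s=1}^k$, $w_A(x)=|\{1\le s\le k: x\in a_s(n_s)\}|$; $A$ is an $m$-cover of $\mathbb Z$ if $w_A(x)\ge m$ for all $x\in\mathbb Z$. -}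

module Defs where

open import Data.Nat as ℕ using (ℕ; _^_; _≤_; NonZero)
open import Data.Nat.Divisibility as ℕD using (_∣?_)
open import Data.Nat.Primality using (Prime)
open import Data.Integer as ℤ using (ℤ; +_; ∣_∣; _-_)
open import Data.Rational as ℚ using (ℚ; 0ℚ)
open import Data.Fin using (Fin)
open import Data.Fin.Subset using (Subset)
open import Data.Vec using (lookup)
open import Data.List using (List; length; filter; foldr; map)
open import Data.List.Base using (allFin)
open import Data.Bool using (if_then_else_)
open import Data.Product using (Σ; ∃; _×_)
open import Relation.Binary.PropositionalEquality using (_≡_)
open import Relation.Nullary using (Dec)

IsPrimePower : ℕ → Set
IsPrimePower m = Σ ℕ λ p → Σ ℕ λ e → Prime p × m ≡ p ^ e

_∈Res_,_ : ℤ → ℤ → ℕ → Set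
x ∈Res a , n = n ℕD.∣ ∣ x - a ∣

_∈Res?_,_ : (x a : ℤ) (n : ℕ) → Dec (x ∈Res a , n)
x ∈Res? a , n = n ∣? ∣ x - a ∣

weight : (k : ℕ) → (Fin k → ℤ) → (Fin k → ℕ) → ℤ → ℕ
weight k a n x = length (filter (λ s → x ∈Res? a s , n s) (allFin k))

IsCover : ℕ → (k : ℕ) → (Fin k → ℤ) → (Fin k → ℕ) → Set
IsCover m k a n = ∀ (x : ℤ) → m ≤ weight k a n x

subsetSum : {k : ℕ} → Subset k → (Fin k → ℚ) → ℚ
subsetSum {k} I f =
  foldr ℚ._+_ 0ℚ (map (λ s → if lookup I s then f s else 0ℚ) (allFin k))

InMultiples : ℕ → ℚ → Set
InMultiples m q = ∃ λ (z : ℤ) → q ≡ (+ m ℚ./ 1) ℚ.* (z ℚ./ 1)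

InPosMultiples : ℕ → ℚ → Set
InPosMultiples m q = ∃ λ (z : ℕ) → 1 ≤ z × q ≡ (+ m ℚ./ 1) ℚ.* (+ z ℚ./ 1)

-- Let N = ∏ n_s. Replacing m_s by its residue modulo m n_s, it suffices to find a nonempty I with
-- m N ∣ ρ_I = ∑_{s ∈ I} r_s, where r_s = m_s N / n_s ∈ ℕ. Suppose there is none, and let
-- sieve x = ∑_T (−1)^|T| [x ≡ ∑_{q ∈ T} N / q (mod N)], T ranging over sets of primes dividing N.
-- For each y, sieve has period y r_s − a_s r_s for the at least m indices s with y ∈ a_s(n_s), and
-- an alternating sum over subsets with that many periods kills every polynomial of degree < m. So,
-- with a_I = ∑_{s ∈ I} a_s r_s and f(x) = (x + N)(x + 2N)⋯(x + (m − 1)N),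
-- ∑_I (−1)^|I| f(ρ_I) sieve(y ρ_I − a_I) = 0. Summing over y < N kills the terms with N ∤ ρ_I, since
-- sieve sums to zero over the cosets of every nonzero subgroup of ℤ/Nℤ. For ρ_I = N R the term is
-- N^m (m − 1)! C(R + m − 1, m − 1) (−1)^|I| sieve(−a_I), and the binomial coefficient is divisible by p
-- unless m ∣ R, which only happens for I = ∅. So p divides the I = ∅ term, which is 1.
-- The claim about J follows by applying this to m_s with the signs flipped on J and replacing I by
-- its symmetric difference with J.

module Submission where

open import Defs
open import Data.Nat using (ℕ; zero; suc; _^_)
open import Relation.Binary.PropositionalEquality using (_≡_)
open import Data.Nat.Primality using (Prime)

module SubsetSums where

  import Data.Nat as ℕ
  import Data.Nat.Properties as ℕ
  open import Data.Nat.Divisibility using (_∣0)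
  open import Data.Integer using (ℤ; +_; _+_; _*_; -_; _-_; 0ℤ; ∣_∣)
  import Data.Integer.Properties as ℤ
  open import Data.Integer.Divisibility.Signed using (_∣_; ∣ᵤ⇒∣; ∣m∣n⇒∣m+n)
  open import Data.Integer.Tactic.RingSolver using (solve-∀)
  open import Data.Fin using (Fin; zero; suc)
  open import Data.Fin.Subset using (Subset; inside; outside; Nonempty) renaming (⊥ to ∅)
  open import Data.Vec using ([]; _∷_; there; lookup; zipWith)
  open import Data.Vec.Properties using (∷-injectiveʳ)
  open import Data.Bool using (_xor_; if_then_else_)
  open import Data.Product using (_,_)
  open import Function using (_∘_)
  open import Relation.Binary.PropositionalEquality

  subsetSumℤ : ∀ {k} → Subset k → (Fin k → ℤ) → ℤ
  subsetSumℤ [] e = 0ℤ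
  subsetSumℤ (outside ∷ I) e = subsetSumℤ I (e ∘ suc)
  subsetSumℤ (inside ∷ I) e = e zero + subsetSumℤ I (e ∘ suc)

  subsetSumℕ : ∀ {k} → Subset k → (Fin k → ℕ) → ℕ
  subsetSumℕ [] r = 0
  subsetSumℕ (outside ∷ I) r = subsetSumℕ I (r ∘ suc)
  subsetSumℕ (inside ∷ I) r = r zero ℕ.+ subsetSumℕ I (r ∘ suc)

  subsetSumℤ-∅ : ∀ {k} (e : Fin k → ℤ) → subsetSumℤ ∅ e ≡ 0ℤ
  subsetSumℤ-∅ {zero} e = refl
  subsetSumℤ-∅ {suc k} e = subsetSumℤ-∅ (e ∘ suc)

  subsetSumℕ-∅ : ∀ {k} (r : Fin k → ℕ) → subsetSumℕ ∅ r ≡ 0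
  subsetSumℕ-∅ {zero} r = refl
  subsetSumℕ-∅ {suc k} r = subsetSumℕ-∅ (r ∘ suc)

  subsetSumℤ-cong : ∀ {k} (I : Subset k) {X Y : Fin k → ℤ} → (∀ s → X s ≡ Y s) → subsetSumℤ I X ≡ subsetSumℤ I Y
  subsetSumℤ-cong [] X≡Y = refl
  subsetSumℤ-cong (outside ∷ I) X≡Y = subsetSumℤ-cong I (X≡Y ∘ suc)
  subsetSumℤ-cong (inside ∷ I) X≡Y = cong₂ _+_ (X≡Y zero) (subsetSumℤ-cong I (X≡Y ∘ suc))

  subsetSumℤ-pos : ∀ {k} (I : Subset k) (r : Fin k → ℕ) → subsetSumℤ I (λ s → + r s) ≡ + subsetSumℕ I r
  subsetSumℤ-pos [] r = refl
  subsetSumℤ-pos (outside ∷ I) r = subsetSumℤ-pos I (r ∘ suc)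
  subsetSumℤ-pos (inside ∷ I) r =
    trans (cong (_+_ (+ r zero)) (subsetSumℤ-pos I (r ∘ suc))) (sym (ℤ.pos-+ (r zero) (subsetSumℕ I (r ∘ suc))))

  subsetSumℤ-linear : ∀ {k} (I : Subset k) (a : ℤ) (r c : Fin k → ℤ) →
    subsetSumℤ I (λ s → a * r s - c s) ≡ a * subsetSumℤ I r - subsetSumℤ I c
  subsetSumℤ-linear [] a r c = sym (trans (ℤ.+-identityʳ (a * 0ℤ)) (ℤ.*-zeroʳ a))
  subsetSumℤ-linear (outside ∷ I) a r c = subsetSumℤ-linear I a (r ∘ suc) (c ∘ suc)
  subsetSumℤ-linear (inside ∷ I) a r c =
    trans (cong (_+_ (a * r zero - c zero)) (subsetSumℤ-linear I a (r ∘ suc) (c ∘ suc)))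
          (regroup a (r zero) (c zero) (subsetSumℤ I (r ∘ suc)) (subsetSumℤ I (c ∘ suc)))
    where
    regroup : ∀ a x y u v → a * x - y + (a * u - v) ≡ a * (x + u) - (y + v)
    regroup = solve-∀

  ∣-subsetSumℤ : ∀ {k} {d} (I : Subset k) (X Y : Fin k → ℤ) →
    (∀ s → d ∣ X s - Y s) → d ∣ subsetSumℤ I X - subsetSumℤ I Y
  ∣-subsetSumℤ {d = d} [] X Y d∣X-Y = ∣ᵤ⇒∣ (∣ d ∣ ∣0)
  ∣-subsetSumℤ (outside ∷ I) X Y d∣X-Y = ∣-subsetSumℤ I (X ∘ suc) (Y ∘ suc) (d∣X-Y ∘ suc)
  ∣-subsetSumℤ {d = d} (inside ∷ I) X Y d∣X-Y =
    subst (d ∣_) (regroup (X zero) (Y zero) (subsetSumℤ I (X ∘ suc)) (subsetSumℤ I (Y ∘ suc)))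
      (∣m∣n⇒∣m+n (d∣X-Y zero) (∣-subsetSumℤ I (X ∘ suc) (Y ∘ suc) (d∣X-Y ∘ suc)))
    where
    regroup : ∀ x y u v → x - y + (u - v) ≡ x + u - (y + v)
    regroup = solve-∀

  subsetSumℕ-positive : ∀ {k} (I : Subset k) (r : Fin k → ℕ) →
    Nonempty I → (∀ s → 1 ℕ.≤ r s) → 1 ℕ.≤ subsetSumℕ I r
  subsetSumℕ-positive (inside ∷ I) r _ r≥1 = ℕ.≤-trans (r≥1 zero) (ℕ.m≤m+n (r zero) _)
  subsetSumℕ-positive (outside ∷ I) r (suc s , there s∈I) r≥1 =
    subsetSumℕ-positive I (r ∘ suc) (s , s∈I) (r≥1 ∘ suc)

  _△_ : ∀ {k} → Subset k → Subset k → Subset k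
  _△_ = zipWith _xor_

  △-≢ : ∀ {k} (I J : Subset k) → Nonempty I → I △ J ≢ J
  △-≢ (inside ∷ I) (inside ∷ J) _ ()
  △-≢ (inside ∷ I) (outside ∷ J) _ ()
  △-≢ (outside ∷ I) (b ∷ J) (suc s , there s∈I) I△J≡J = △-≢ I J (s , s∈I) (∷-injectiveʳ I△J≡J)

  subsetSumℤ-△ : ∀ {k} (I J : Subset k) (X : Fin k → ℤ) →
    subsetSumℤ (I △ J) X - subsetSumℤ J X ≡ subsetSumℤ I (λ s → if lookup J s then - X s else X s)
  subsetSumℤ-△ [] [] X = refl
  subsetSumℤ-△ (outside ∷ I) (outside ∷ J) X = subsetSumℤ-△ I J (X ∘ suc)
  subsetSumℤ-△ (outside ∷ I) (inside ∷ J) X =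
    trans (cancel (X zero) (subsetSumℤ (I △ J) (X ∘ suc)) (subsetSumℤ J (X ∘ suc))) (subsetSumℤ-△ I J (X ∘ suc))
    where
    cancel : ∀ x a b → x + a - (x + b) ≡ a - b
    cancel = solve-∀
  subsetSumℤ-△ (inside ∷ I) (outside ∷ J) X =
    trans (assoc (X zero) (subsetSumℤ (I △ J) (X ∘ suc)) (subsetSumℤ J (X ∘ suc)))
          (cong (_+_ (X zero)) (subsetSumℤ-△ I J (X ∘ suc)))
    where
    assoc : ∀ x a b → x + a - b ≡ x + (a - b)
    assoc = solve-∀
  subsetSumℤ-△ (inside ∷ I) (inside ∷ J) X =
    trans (cancel (X zero) (subsetSumℤ (I △ J) (X ∘ suc)) (subsetSumℤ J (X ∘ suc)))
          (cong (_+_ (- X zero)) (subsetSumℤ-△ I J (X ∘ suc)))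
    where
    cancel : ∀ x a b → a - (x + b) ≡ - x + (a - b)
    cancel = solve-∀

module SumsOverSubsets where

  open import Data.Nat using (zero; suc)
  open import Data.Nat.Divisibility using (_∣0)
  open import Data.Integer using (ℤ; _+_; _*_; -_; _-_; 0ℤ; 1ℤ; ∣_∣)
  import Data.Integer.Properties as ℤ
  open import Data.Integer.Divisibility.Signed using (_∣_; ∣ᵤ⇒∣; ∣m∣n⇒∣m+n)
  open import Data.Integer.Tactic.RingSolver using (solve-∀)
  open import Data.Fin using (zero; suc)
  open import Data.Fin.Subset using (Subset; inside; outside; Nonempty) renaming (⊥ to ∅)
  open import Data.Vec using ([]; _∷_; here; there)
  open import Data.Product using (_,_)
  open import Function using (_∘_)
  open import Relation.Binary.PropositionalEquality
  open ≡-Reasoning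

  sumOverSubsets : ∀ {k} → (Subset k → ℤ) → ℤ
  sumOverSubsets {zero} g = g []
  sumOverSubsets {suc k} g = sumOverSubsets (g ∘ (outside ∷_)) + sumOverSubsets (g ∘ (inside ∷_))

  sumOverSubsets-0 : ∀ {k} → sumOverSubsets {k} (λ _ → 0ℤ) ≡ 0ℤ
  sumOverSubsets-0 {zero} = refl
  sumOverSubsets-0 {suc k} = cong₂ _+_ (sumOverSubsets-0 {k}) (sumOverSubsets-0 {k})

  sumOverSubsets-cong : ∀ {k} {g h : Subset k → ℤ} → (∀ I → g I ≡ h I) → sumOverSubsets g ≡ sumOverSubsets h
  sumOverSubsets-cong {zero} g≡h = g≡h []
  sumOverSubsets-cong {suc k} g≡h =
    cong₂ _+_ (sumOverSubsets-cong (g≡h ∘ (outside ∷_))) (sumOverSubsets-cong (g≡h ∘ (inside ∷_)))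

  sumOverSubsets-*ˡ : ∀ {k} c (g : Subset k → ℤ) → sumOverSubsets (λ I → c * g I) ≡ c * sumOverSubsets g
  sumOverSubsets-*ˡ {zero} c g = refl
  sumOverSubsets-*ˡ {suc k} c g = begin
    sumOverSubsets (λ I → c * g (outside ∷ I)) + sumOverSubsets (λ I → c * g (inside ∷ I))
      ≡⟨ cong₂ _+_ (sumOverSubsets-*ˡ c (g ∘ (outside ∷_))) (sumOverSubsets-*ˡ c (g ∘ (inside ∷_))) ⟩
    c * sumOverSubsets (g ∘ (outside ∷_)) + c * sumOverSubsets (g ∘ (inside ∷_))
      ≡⟨ ℤ.*-distribˡ-+ c _ _ ⟨
    c * sumOverSubsets g ∎

  sumOverSubsets-neg : ∀ {k} (g : Subset k → ℤ) → sumOverSubsets (λ I → - g I) ≡ - sumOverSubsets g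
  sumOverSubsets-neg g = begin
    sumOverSubsets (λ I → - g I)        ≡⟨ sumOverSubsets-cong (λ I → ℤ.-1*i≡-i (g I)) ⟨
    sumOverSubsets (λ I → - 1ℤ * g I)   ≡⟨ sumOverSubsets-*ˡ (- 1ℤ) g ⟩
    - 1ℤ * sumOverSubsets g             ≡⟨ ℤ.-1*i≡-i _ ⟩
    - sumOverSubsets g                  ∎

  sumOverSubsets-+ : ∀ {k} (g h : Subset k → ℤ) →
    sumOverSubsets (λ I → g I + h I) ≡ sumOverSubsets g + sumOverSubsets h
  sumOverSubsets-+ {zero} g h = refl
  sumOverSubsets-+ {suc k} g h = begin
    sumOverSubsets (λ I → g₀ I + h₀ I) + sumOverSubsets (λ I → g₁ I + h₁ I)
      ≡⟨ cong₂ _+_ (sumOverSubsets-+ g₀ h₀) (sumOverSubsets-+ g₁ h₁) ⟩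
    (sumOverSubsets g₀ + sumOverSubsets h₀) + (sumOverSubsets g₁ + sumOverSubsets h₁)
      ≡⟨ interchange (sumOverSubsets g₀) (sumOverSubsets h₀) (sumOverSubsets g₁) (sumOverSubsets h₁) ⟩
    sumOverSubsets g + sumOverSubsets h ∎
    where
    g₀ g₁ h₀ h₁ : Subset k → ℤ
    g₀ = g ∘ (outside ∷_)
    g₁ = g ∘ (inside ∷_)
    h₀ = h ∘ (outside ∷_)
    h₁ = h ∘ (inside ∷_)
    interchange : ∀ a b c d → (a + b) + (c + d) ≡ (a + c) + (b + d)
    interchange = solve-∀

  sumOverSubsets-− : ∀ {k} (g h : Subset k → ℤ) →
    sumOverSubsets (λ I → g I - h I) ≡ sumOverSubsets g - sumOverSubsets h
  sumOverSubsets-− g h =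
    trans (sumOverSubsets-+ g (λ I → - h I)) (cong (_+_ (sumOverSubsets g)) (sumOverSubsets-neg h))

  ∣-sumOverSubsets : ∀ {k} {d} (g : Subset k → ℤ) → (∀ I → d ∣ g I) → d ∣ sumOverSubsets g
  ∣-sumOverSubsets {zero} g d∣g = d∣g []
  ∣-sumOverSubsets {suc k} g d∣g =
    ∣m∣n⇒∣m+n (∣-sumOverSubsets (g ∘ (outside ∷_)) (d∣g ∘ (outside ∷_)))
              (∣-sumOverSubsets (g ∘ (inside ∷_)) (d∣g ∘ (inside ∷_)))

  ∣-sumOverSubsets-nonempty : ∀ {k} {d} (g : Subset k → ℤ) →
    (∀ I → Nonempty I → d ∣ g I) → d ∣ sumOverSubsets g - g ∅
  ∣-sumOverSubsets-nonempty {zero} {d} g d∣g = subst (d ∣_) (sym (ℤ.+-inverseʳ (g []))) (∣ᵤ⇒∣ (∣ d ∣ ∣0))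
  ∣-sumOverSubsets-nonempty {suc k} {d} g d∣g =
    subst (d ∣_) (regroup (sumOverSubsets (g ∘ (outside ∷_))) (sumOverSubsets (g ∘ (inside ∷_))) (g ∅))
      (∣m∣n⇒∣m+n
        (∣-sumOverSubsets-nonempty (g ∘ (outside ∷_))
          (λ { I (s , s∈I) → d∣g (outside ∷ I) (suc s , there s∈I) }))
        (∣-sumOverSubsets (g ∘ (inside ∷_)) (λ I → d∣g (inside ∷ I) (zero , here))))
    where
    regroup : ∀ a b c → a - c + b ≡ a + b - c
    regroup = solve-∀

  sign : ∀ {k} → Subset k → ℤ
  sign [] = 1ℤ
  sign (outside ∷ I) = sign I
  sign (inside ∷ I) = - sign I

  sign-∅ : ∀ k → sign (∅ {k}) ≡ 1ℤ
  sign-∅ zero = refl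
  sign-∅ (suc k) = sign-∅ k

module SumsBelow where

  open import Data.Nat as ℕ using (zero; suc)
  import Data.Nat.Properties as ℕ
  open import Data.Integer using (ℤ; +_; _+_; _*_; _-_; 0ℤ; 1ℤ)
  import Data.Integer.Properties as ℤ
  open import Data.Integer.Tactic.RingSolver using (solve-∀)
  open import Data.Fin.Subset using (Subset)
  open import Algebra.Properties.AbelianGroup ℤ.+-0-abelianGroup using () renaming (∙-cancelʳ to +-cancelʳ)
  open import Relation.Binary.PropositionalEquality
  open ≡-Reasoning
  open SumsOverSubsets using (sumOverSubsets; sumOverSubsets-0; sumOverSubsets-+)

  sumBelow : ℕ → (ℕ → ℤ) → ℤ
  sumBelow zero F = 0ℤ
  sumBelow (suc n) F = sumBelow n F + F n

  sumBelow-cong : ∀ n {F G : ℕ → ℤ} → (∀ y → F y ≡ G y) → sumBelow n F ≡ sumBelow n G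
  sumBelow-cong zero F≡G = refl
  sumBelow-cong (suc n) F≡G = cong₂ _+_ (sumBelow-cong n F≡G) (F≡G n)

  sumBelow-*ˡ : ∀ n c (F : ℕ → ℤ) → sumBelow n (λ y → c * F y) ≡ c * sumBelow n F
  sumBelow-*ˡ zero c F = sym (ℤ.*-zeroʳ c)
  sumBelow-*ˡ (suc n) c F =
    trans (cong (_+ c * F n) (sumBelow-*ˡ n c F)) (sym (ℤ.*-distribˡ-+ c (sumBelow n F) (F n)))

  sumBelow-const : ∀ n c → sumBelow n (λ _ → c) ≡ + n * c
  sumBelow-const zero c = sym (ℤ.*-zeroˡ c)
  sumBelow-const (suc n) c = trans (cong (_+ c) (sumBelow-const n c)) (step (+ n) c)
    where
    step : ∀ n c → n * c + c ≡ (1ℤ + n) * c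
    step = solve-∀

  sumBelow-− : ∀ n (F G : ℕ → ℤ) → sumBelow n (λ y → F y - G y) ≡ sumBelow n F - sumBelow n G
  sumBelow-− zero F G = refl
  sumBelow-− (suc n) F G =
    trans (cong (_+ (F n - G n)) (sumBelow-− n F G)) (interchange (sumBelow n F) (sumBelow n G) (F n) (G n))
    where
    interchange : ∀ a b c d → a - b + (c - d) ≡ (a + c) - (b + d)
    interchange = solve-∀

  sumBelow-rotate : ∀ n (F : ℕ → ℤ) → sumBelow n (λ y → F (suc y)) + F 0 ≡ sumBelow n F + F n
  sumBelow-rotate zero F = refl
  sumBelow-rotate (suc n) F = begin
    sumBelow n (λ y → F (suc y)) + F (suc n) + F 0  ≡⟨ swap (sumBelow n (λ y → F (suc y))) (F (suc n)) (F 0) ⟩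
    sumBelow n (λ y → F (suc y)) + F 0 + F (suc n)  ≡⟨ cong (_+ F (suc n)) (sumBelow-rotate n F) ⟩
    sumBelow n F + F n + F (suc n)                  ∎
    where
    swap : ∀ a b c → a + b + c ≡ a + c + b
    swap = solve-∀

  sumBelow-shift : ∀ n (F : ℕ → ℤ) → (∀ y → F (y ℕ.+ n) ≡ F y) →
    ∀ u → sumBelow n (λ y → F (y ℕ.+ u)) ≡ sumBelow n F
  sumBelow-shift n F periodic zero = sumBelow-cong n (λ y → cong F (ℕ.+-identityʳ y))
  sumBelow-shift n F periodic (suc u) = begin
    sumBelow n (λ y → F (y ℕ.+ suc u))   ≡⟨ sumBelow-cong n (λ y → cong F (ℕ.+-suc y u)) ⟩
    sumBelow n (λ y → G (suc y))         ≡⟨ +-cancelʳ (G 0) _ _ rotate ⟩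
    sumBelow n G                         ≡⟨ sumBelow-shift n F periodic u ⟩
    sumBelow n F                         ∎
    where
    G : ℕ → ℤ
    G y = F (y ℕ.+ u)
    rotate : sumBelow n (λ y → G (suc y)) + G 0 ≡ sumBelow n G + G 0
    rotate = trans (sumBelow-rotate n G)
                   (cong (_+_ (sumBelow n G)) (trans (cong F (ℕ.+-comm n u)) (periodic u)))

  sumBelow-sumOverSubsets : ∀ {k} n (G : ℕ → Subset k → ℤ) →
    sumBelow n (λ y → sumOverSubsets (G y)) ≡ sumOverSubsets (λ I → sumBelow n (λ y → G y I))
  sumBelow-sumOverSubsets {k} zero G = sym (sumOverSubsets-0 {k})
  sumBelow-sumOverSubsets (suc n) G =
    trans (cong (_+ sumOverSubsets (G n)) (sumBelow-sumOverSubsets n G))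
          (sym (sumOverSubsets-+ (λ I → sumBelow n (λ y → G y I)) (G n)))

module FiniteDifferences where

  open import Data.Nat as ℕ using (ℕ; zero; suc)
  open import Data.Integer using (ℤ; +_; _+_; _*_; _-_; 0ℤ; 1ℤ)
  import Data.Integer.Properties as ℤ
  open import Data.Integer.Tactic.RingSolver using (solve-∀)
  open import Relation.Binary.PropositionalEquality

  Degree< : ℕ → (ℤ → ℤ) → Set
  Degree< zero f = ∀ x → f x ≡ 0ℤ
  Degree< (suc d) f = ∀ r → Degree< d (λ x → f (x + r) - f x)

  Degree<-cong : ∀ d {f g : ℤ → ℤ} → (∀ x → f x ≡ g x) → Degree< d f → Degree< d g
  Degree<-cong zero f≡g df x = trans (sym (f≡g x)) (df x)
  Degree<-cong (suc d) f≡g df r = Degree<-cong d (λ x → cong₂ _-_ (f≡g (x + r)) (f≡g x)) (df r)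

  Degree<-zero : ∀ d {f : ℤ → ℤ} → (∀ x → f x ≡ 0ℤ) → Degree< d f
  Degree<-zero zero f≡0 = f≡0
  Degree<-zero (suc d) f≡0 r = Degree<-zero d (λ x → cong₂ _-_ (f≡0 (x + r)) (f≡0 x))

  Degree<-+ : ∀ d {f g : ℤ → ℤ} → Degree< d f → Degree< d g → Degree< d (λ x → f x + g x)
  Degree<-+ zero df dg x = cong₂ _+_ (df x) (dg x)
  Degree<-+ (suc d) {f} {g} df dg r =
    Degree<-cong d (λ x → Δ-+ (f (x + r)) (f x) (g (x + r)) (g x)) (Degree<-+ d (df r) (dg r))
    where
    Δ-+ : ∀ a b c e → (a - b) + (c - e) ≡ (a + c) - (b + e)
    Δ-+ = solve-∀

  Degree<-*ˡ : ∀ d c {f : ℤ → ℤ} → Degree< d f → Degree< d (λ x → c * f x)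
  Degree<-*ˡ zero c df x = trans (cong (c *_) (df x)) (ℤ.*-zeroʳ c)
  Degree<-*ˡ (suc d) c {f} df r =
    Degree<-cong d (λ x → distrib c (f (x + r)) (f x)) (Degree<-*ˡ d c (df r))
    where
    distrib : ∀ c a b → c * (a - b) ≡ c * a - c * b
    distrib = solve-∀

  Degree<-shift : ∀ d u {f : ℤ → ℤ} → Degree< d f → Degree< d (λ x → f (x + u))
  Degree<-shift zero u df x = df (x + u)
  Degree<-shift (suc d) u {f} df r =
    Degree<-cong d (λ x → cong (λ y → f y - f (x + u)) (swap x u r)) (Degree<-shift d u (df r))
    where
    swap : ∀ x u r → (x + u) + r ≡ (x + r) + u
    swap = solve-∀

  Degree<-mulLinear : ∀ d c {g : ℤ → ℤ} → Degree< d g → Degree< (suc d) (λ x → (x + c) * g x)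
  Degree<-mulLinear zero c dg = Degree<-zero 1 (λ x → trans (cong ((x + c) *_) (dg x)) (ℤ.*-zeroʳ (x + c)))
  Degree<-mulLinear (suc d) c {g} dg r =
    Degree<-cong (suc d) (λ x → Δ-mulLinear x r c (g (x + r)) (g x))
      (Degree<-+ (suc d) {λ x → (x + c) * (g (x + r) - g x)} {λ x → r * g (x + r)}
        (Degree<-mulLinear d c (dg r)) (Degree<-*ˡ (suc d) r (Degree<-shift (suc d) r {g} dg)))
    where
    Δ-mulLinear : ∀ x r c u v → (x + c) * (u - v) + r * u ≡ (x + r + c) * u - (x + c) * v
    Δ-mulLinear = solve-∀

  rising : ℕ → ℕ → ℤ → ℤ
  rising N zero x = 1ℤ
  rising N (suc j) x = (x + + (suc j ℕ.* N)) * rising N j x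

  Degree<-rising : ∀ N j → Degree< (suc j) (rising N j)
  Degree<-rising N zero r x = refl
  Degree<-rising N (suc j) = Degree<-mulLinear (suc j) (+ (suc j ℕ.* N)) (Degree<-rising N j)

module AlternatingSums where

  open import Data.Nat as ℕ using (zero; suc; s≤s)
  open import Data.Integer using (ℤ; _+_; _*_; -_; _-_; 0ℤ; 1ℤ)
  import Data.Integer.Properties as ℤ
  open import Data.Integer.Tactic.RingSolver using (solve-∀)
  open import Data.Fin using (Fin; zero; suc)
  open import Data.Fin.Subset using (Subset; inside; outside; _∈_; ∣_∣)
  open import Data.Vec using ([]; _∷_; here; there)
  open import Function using (_∘_)
  open import Relation.Binary.PropositionalEquality
  open ≡-Reasoning
  open SubsetSums using (subsetSumℤ)
  open SumsOverSubsets
  open FiniteDifferences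

  alternatingSum : ∀ {k} → (f : ℤ → ℤ) (r : Fin k → ℤ) (φ : ℤ → ℤ) (e : Fin k → ℤ) → ℤ
  alternatingSum f r φ e = sumOverSubsets (λ I → sign I * f (subsetSumℤ I r) * φ (subsetSumℤ I e))

  alternatingSum-suc : ∀ {k} (f : ℤ → ℤ) (r : Fin (suc k) → ℤ) (φ : ℤ → ℤ) (e : Fin (suc k) → ℤ) →
    alternatingSum f r φ e ≡
      alternatingSum f (r ∘ suc) φ (e ∘ suc)
        - alternatingSum (λ x → f (x + r zero)) (r ∘ suc) (λ x → φ (x + e zero)) (e ∘ suc)
  alternatingSum-suc {k} f r φ e = cong (_+_ (alternatingSum f r′ φ e′)) (begin
    sumOverSubsets (λ I → - sign I * f (r zero + subsetSumℤ I r′) * φ (e zero + subsetSumℤ I e′))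
      ≡⟨ sumOverSubsets-cong term ⟩
    sumOverSubsets (λ I → - g I)
      ≡⟨ sumOverSubsets-neg g ⟩
    - sumOverSubsets g ∎)
    where
    r′ e′ : Fin k → ℤ
    r′ = r ∘ suc
    e′ = e ∘ suc
    g : Subset k → ℤ
    g I = sign I * f (subsetSumℤ I r′ + r zero) * φ (subsetSumℤ I e′ + e zero)
    neg-assoc : ∀ a b c → - a * b * c ≡ - (a * b * c)
    neg-assoc = solve-∀
    term : ∀ I → - sign I * f (r zero + subsetSumℤ I r′) * φ (e zero + subsetSumℤ I e′) ≡ - g I
    term I rewrite ℤ.+-comm (r zero) (subsetSumℤ I r′) | ℤ.+-comm (e zero) (subsetSumℤ I e′) =
      neg-assoc (sign I) _ _

  alternatingSum-−ˡ : ∀ {k} (f g : ℤ → ℤ) (r : Fin k → ℤ) (φ : ℤ → ℤ) (e : Fin k → ℤ) →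
    alternatingSum f r φ e - alternatingSum g r φ e ≡ alternatingSum (λ x → f x - g x) r φ e
  alternatingSum-−ˡ f g r φ e =
    trans (sym (sumOverSubsets-− (term f) (term g)))
          (sumOverSubsets-cong λ I →
            distrib (sign I) (f (subsetSumℤ I r)) (g (subsetSumℤ I r)) (φ (subsetSumℤ I e)))
    where
    term : (ℤ → ℤ) → Subset _ → ℤ
    term h I = sign I * h (subsetSumℤ I r) * φ (subsetSumℤ I e)
    distrib : ∀ a u v b → a * u * b - a * v * b ≡ a * (u - v) * b
    distrib = solve-∀

  alternatingSum-congʳ : ∀ {k} (f : ℤ → ℤ) (r : Fin k → ℤ) {φ ψ : ℤ → ℤ} (e : Fin k → ℤ) →
    (∀ x → φ x ≡ ψ x) → alternatingSum f r φ e ≡ alternatingSum f r ψ e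
  alternatingSum-congʳ f r e φ≡ψ =
    sumOverSubsets-cong (λ I → cong (sign I * f (subsetSumℤ I r) *_) (φ≡ψ (subsetSumℤ I e)))

  Periodic : ∀ {k} → Subset k → (Fin k → ℤ) → (ℤ → ℤ) → Set
  Periodic T e φ = ∀ {s} → s ∈ T → ∀ x → φ (x + e s) ≡ φ x

  Periodic-shift : ∀ {k} {T : Subset k} {e} {φ} c → Periodic T e φ → Periodic T e (λ x → φ (x + c))
  Periodic-shift {e = e} {φ} c periodic {s} s∈T x =
    trans (cong φ (swap x (e s) c)) (periodic s∈T (x + c))
    where
    swap : ∀ x y c → x + y + c ≡ x + c + y
    swap = solve-∀

  -- Pairing I with its symmetric difference with {s}, for a period e s of φ, turns the sum
  -- into the alternating sum of a finite difference of f, of lower degree.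
  alternatingSum-vanishes : ∀ {k} (T : Subset k) {r e : Fin k → ℤ} {d} {f φ : ℤ → ℤ} →
    Degree< d f → Periodic T e φ → d ℕ.≤ ∣ T ∣ → alternatingSum f r φ e ≡ 0ℤ
  alternatingSum-vanishes {k} T {r} {e} {zero} {f} {φ} f≡0 _ _ =
    trans (sumOverSubsets-cong term≡0) (sumOverSubsets-0 {k})
    where
    term≡0 : ∀ I → sign I * f (subsetSumℤ I r) * φ (subsetSumℤ I e) ≡ 0ℤ
    term≡0 I = trans (cong (λ y → sign I * y * φ (subsetSumℤ I e)) (f≡0 (subsetSumℤ I r)))
                     (cong (_* φ (subsetSumℤ I e)) (ℤ.*-zeroʳ (sign I)))
  alternatingSum-vanishes [] {d = suc d} _ _ ()
  alternatingSum-vanishes (outside ∷ T) {r} {e} {suc d} {f} {φ} df periodic d≤∣T∣ =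
    trans (alternatingSum-suc f r φ e)
      (cong₂ _-_ (alternatingSum-vanishes T {f = f} df (λ s∈T → periodic (there s∈T)) d≤∣T∣)
                 (alternatingSum-vanishes T {f = λ x → f (x + r zero)} (Degree<-shift (suc d) (r zero) {f} df)
                   (Periodic-shift (e zero) (λ s∈T → periodic (there s∈T))) d≤∣T∣))
  alternatingSum-vanishes (inside ∷ T) {r} {e} {suc d} {f} {φ} df periodic (s≤s d≤∣T∣) = begin
    alternatingSum f r φ e
      ≡⟨ alternatingSum-suc f r φ e ⟩
    alternatingSum f r′ φ e′ - alternatingSum f′ r′ (λ x → φ (x + e zero)) e′
      ≡⟨ cong (_-_ (alternatingSum f r′ φ e′)) (alternatingSum-congʳ f′ r′ e′ (periodic here)) ⟩
    alternatingSum f r′ φ e′ - alternatingSum f′ r′ φ e′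
      ≡⟨ alternatingSum-−ˡ f f′ r′ φ e′ ⟩
    alternatingSum (λ x → f x - f (x + r zero)) r′ φ e′
      ≡⟨ alternatingSum-vanishes T backwardΔ (λ s∈T → periodic (there s∈T)) d≤∣T∣ ⟩
    0ℤ ∎
    where
    r′ e′ : Fin _ → ℤ
    r′ = r ∘ suc
    e′ = e ∘ suc
    f′ : ℤ → ℤ
    f′ x = f (x + r zero)
    flip : ∀ a b → - 1ℤ * (a - b) ≡ b - a
    flip = solve-∀
    backwardΔ : Degree< d (λ x → f x - f (x + r zero))
    backwardΔ = Degree<-cong d (λ x → flip (f (x + r zero)) (f x)) (Degree<-*ˡ d (- 1ℤ) (df (r zero)))

module Binomials where

  open import Data.Nat using (zero; suc; _+_; _*_; _!)
  open import Data.Nat.Properties using (*-zeroʳ; *-identityʳ; +-identityʳ; +-suc)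
  open import Data.Nat.Combinatorics using (_C_; nC1≡n; nCk+nC[k+1]≡[n+1]C[k+1])
  open import Data.Nat.Tactic.RingSolver using (solve-∀)
  import Data.Integer as ℤ
  import Data.Integer.Properties as ℤ
  open import Relation.Binary.PropositionalEquality
  open ≡-Reasoning
  open FiniteDifferences using (rising)

  [k+1]*[n+1]C[k+1]≡[n+1]*nCk : ∀ n k → suc k * (suc n C suc k) ≡ suc n * (n C k)
  [k+1]*[n+1]C[k+1]≡[n+1]*nCk zero zero = refl
  [k+1]*[n+1]C[k+1]≡[n+1]*nCk zero (suc k) = *-zeroʳ (suc (suc k))
  [k+1]*[n+1]C[k+1]≡[n+1]*nCk (suc n) zero =
    trans (+-identityʳ (suc (suc n) C 1)) (trans (nC1≡n (suc (suc n))) (sym (*-identityʳ (suc (suc n)))))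
  [k+1]*[n+1]C[k+1]≡[n+1]*nCk (suc n) (suc k) = begin
    suc (suc k) * (suc (suc n) C suc (suc k))
      ≡⟨ cong (suc (suc k) *_) (nCk+nC[k+1]≡[n+1]C[k+1] (suc n) (suc k)) ⟨
    suc (suc k) * (a + b)
      ≡⟨ regroup a b k ⟩
    a + suc k * a + suc (suc k) * b
      ≡⟨ cong₂ (λ u v → a + u + v) ([k+1]*[n+1]C[k+1]≡[n+1]*nCk n k)
                                    ([k+1]*[n+1]C[k+1]≡[n+1]*nCk n (suc k)) ⟩
    a + suc n * (n C k) + suc n * (n C suc k)
      ≡⟨ regroup′ a (n C k) (n C suc k) n ⟩
    a + suc n * (n C k + n C suc k)
      ≡⟨ cong (λ c → a + suc n * c) (nCk+nC[k+1]≡[n+1]C[k+1] n k) ⟩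
    suc (suc n) * a ∎
    where
    a b : ℕ
    a = suc n C suc k
    b = suc n C suc (suc k)
    regroup : ∀ a b k → suc (suc k) * (a + b) ≡ a + suc k * a + suc (suc k) * b
    regroup = solve-∀
    regroup′ : ∀ a x y n → a + suc n * x + suc n * y ≡ a + suc n * (x + y)
    regroup′ = solve-∀

  rising-eval : ∀ N j R → rising N j (ℤ.+ (N * R)) ≡ ℤ.+ (N ^ j * (j ! * ((R + j) C j)))
  rising-eval N zero R = refl
  rising-eval N (suc j) R = begin
    (ℤ.+ (N * R) ℤ.+ ℤ.+ (suc j * N)) ℤ.* rising N j (ℤ.+ (N * R))
      ≡⟨ cong₂ ℤ._*_ (ℤ.pos-+ (N * R) (suc j * N)) (sym (rising-eval N j R)) ⟨
    ℤ.+ (N * R + suc j * N) ℤ.* ℤ.+ (N ^ j * (j ! * ((R + j) C j)))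
      ≡⟨ ℤ.pos-* (N * R + suc j * N) _ ⟨
    ℤ.+ ((N * R + suc j * N) * (N ^ j * (j ! * ((R + j) C j))))
      ≡⟨ cong ℤ.+_ eval ⟩
    ℤ.+ (N ^ suc j * (suc j ! * ((R + suc j) C suc j))) ∎
    where
    eval : (N * R + suc j * N) * (N ^ j * (j ! * ((R + j) C j)))
         ≡ N ^ suc j * (suc j ! * ((R + suc j) C suc j))
    eval rewrite +-suc R j = begin
      (N * R + suc j * N) * (N ^ j * (j ! * ((R + j) C j)))
        ≡⟨ regroup N R j (N ^ j) (j !) ((R + j) C j) ⟩
      N * N ^ j * (j ! * (suc (R + j) * ((R + j) C j)))
        ≡⟨ cong (λ c → N * N ^ j * (j ! * c)) ([k+1]*[n+1]C[k+1]≡[n+1]*nCk (R + j) j) ⟨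
      N * N ^ j * (j ! * (suc j * (suc (R + j) C suc j)))
        ≡⟨ regroup′ (N * N ^ j) (j !) (suc j) (suc (R + j) C suc j) ⟩
      N * N ^ j * (suc j * j ! * (suc (R + j) C suc j)) ∎
      where
      regroup : ∀ N R j P f c → (N * R + suc j * N) * (P * (f * c)) ≡ N * P * (f * (suc (R + j) * c))
      regroup = solve-∀
      regroup′ : ∀ P f s c → P * (f * (s * c)) ≡ P * (s * f * c)
      regroup′ = solve-∀

module PrimePowerBinomials where

  open import Data.Nat using (ℕ; zero; suc; _+_; _*_; _<_; z≤n; s≤s; NonZero; ≢-nonZero⁻¹)
  open import Data.Nat.Properties
    using (m^n≢0; *-comm; +-identityʳ; <-trans; n<1+n; ≤-refl; ≤-pred; <⇒≱; m≤n⇒m<n∨m≡n)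
  open import Data.Nat.Divisibility
    using ( _∣_; _∣?_; divides; ∣-trans; m∣m*n; *-monoʳ-∣; *-cancelˡ-∣; ∣⇒≤; 1∣_; ∣-reflexive
          ; n∣m⇒m%n≡0; m%n≡0⇒n∣m)
  open import Data.Nat.DivMod using (_%_; _/_; %-distribˡ-+; m≡m%n+[m/n]*n; m%n<n; m*n%n≡0)
  open import Data.Nat.Combinatorics using (_C_; k>n⇒nCk≡0; nCk+nC[k+1]≡[n+1]C[k+1])
  open import Data.Nat.Primality using (Prime; euclidsLemma; prime⇒nonZero)
  open import Data.Nat.Tactic.RingSolver using (solve-∀)
  open import Data.Sum using (inj₁; inj₂)
  open import Data.Empty using (⊥-elim)
  open import Relation.Nullary using (¬_; yes; no)
  open import Relation.Binary.PropositionalEquality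
  open ≡-Reasoning
  open Binomials using ([k+1]*[n+1]C[k+1]≡[n+1]*nCk)

  p^e∣i*c∧p∤c⇒p^e∣i : ∀ {p} → Prime p → ∀ e i c → ¬ (p ∣ c) → p ^ e ∣ i * c → p ^ e ∣ i
  p^e∣i*c∧p∤c⇒p^e∣i p-prime zero i c p∤c _ = 1∣ i
  p^e∣i*c∧p∤c⇒p^e∣i {p} p-prime (suc e) i c p∤c p^[1+e]∣i*c
    with euclidsLemma i c p-prime (∣-trans (m∣m*n (p ^ e)) p^[1+e]∣i*c)
  ... | inj₂ p∣c = ⊥-elim (p∤c p∣c)
  ... | inj₁ (divides q refl) =
    ∣-trans (*-monoʳ-∣ p (p^e∣i*c∧p∤c⇒p^e∣i p-prime e q c p∤c p^e∣q*c)) (∣-reflexive (*-comm p q))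
    where
    instance
      p≢0 : NonZero p
      p≢0 = prime⇒nonZero p-prime
    p^e∣q*c : p ^ e ∣ q * c
    p^e∣q*c = *-cancelˡ-∣ p (subst (p * p ^ e ∣_) (regroup q p c) p^[1+e]∣i*c)
      where
      regroup : ∀ q p c → q * p * c ≡ p * (q * c)
      regroup = solve-∀

  p^e≢0 : ∀ {p} → Prime p → ∀ e → p ^ e ≢ 0
  p^e≢0 {p} p-prime e = ≢-nonZero⁻¹ (p ^ e) {{m^n≢0 p e {{prime⇒nonZero p-prime}}}}

  module _ {p e} (p-prime : Prime p) (m′ : ℕ) (m≡p^e : suc m′ ≡ p ^ e) where

    private
      m : ℕ
      m = suc m′
      instance
        p≢0 : NonZero p
        p≢0 = prime⇒nonZero p-prime

    p∣mCi : ∀ i → 0 < i → i < m → p ∣ m C i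
    p∣mCi (suc i) _ i<m with p ∣? m C suc i
    ... | yes p∣mCi = p∣mCi
    ... | no p∤mCi = ⊥-elim (<⇒≱ i<m (∣⇒≤ m∣1+i))
      where
      m∣1+i : m ∣ suc i
      m∣1+i = subst (_∣ suc i) (sym m≡p^e) (p^e∣i*c∧p∤c⇒p^e∣i p-prime e (suc i) (m C suc i) p∤mCi
        (subst (_∣ suc i * (m C suc i)) m≡p^e
          (subst (m ∣_) (sym ([k+1]*[n+1]C[k+1]≡[n+1]*nCk m′ i)) (m∣m*n (m′ C i)))))

    %-cong-+ : ∀ {a b c d} → a % p ≡ c % p → b % p ≡ d % p → (a + b) % p ≡ (c + d) % p
    %-cong-+ {a} {b} {c} {d} a≡c b≡d = begin
      (a + b) % p             ≡⟨ %-distribˡ-+ a b p ⟩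
      (a % p + b % p) % p     ≡⟨ cong₂ (λ x y → (x + y) % p) a≡c b≡d ⟩
      (c % p + d % p) % p     ≡⟨ %-distribˡ-+ c d p ⟨
      (c + d) % p             ∎

    -- Row m of Pascal's triangle is 1 0 ⋯ 0 1 mod p, and Pascal's rule carries this to every later row.
    [x+m]Cj≡xCj-mod-p : ∀ x j → j < m → ((x + m) C j) % p ≡ (x C j) % p
    [x+m]Cj≡xCj-mod-p zero zero _ = refl
    [x+m]Cj≡xCj-mod-p zero (suc j) j<m =
      trans (n∣m⇒m%n≡0 _ p (p∣mCi (suc j) (s≤s z≤n) j<m)) (sym (m*n%n≡0 0 p))
    [x+m]Cj≡xCj-mod-p (suc x) zero _ = refl
    [x+m]Cj≡xCj-mod-p (suc x) (suc j) j<m = begin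
      (suc (x + m) C suc j) % p
        ≡⟨ cong (_% p) (nCk+nC[k+1]≡[n+1]C[k+1] (x + m) j) ⟨
      ((x + m) C j + (x + m) C suc j) % p
        ≡⟨ %-cong-+ ([x+m]Cj≡xCj-mod-p x j (<-trans (n<1+n j) j<m)) ([x+m]Cj≡xCj-mod-p x (suc j) j<m) ⟩
      (x C j + x C suc j) % p
        ≡⟨ cong (_% p) (nCk+nC[k+1]≡[n+1]C[k+1] x j) ⟩
      (suc x C suc j) % p ∎

    [x+qm]Cj≡xCj-mod-p : ∀ q x j → j < m → ((x + q * m) C j) % p ≡ (x C j) % p
    [x+qm]Cj≡xCj-mod-p zero x j j<m = cong (λ y → (y C j) % p) (+-identityʳ x)
    [x+qm]Cj≡xCj-mod-p (suc q) x j j<m = begin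
      ((x + (m + q * m)) C j) % p   ≡⟨ cong (λ y → (y C j) % p) (regroup x m (q * m)) ⟩
      ((x + q * m + m) C j) % p     ≡⟨ [x+m]Cj≡xCj-mod-p (x + q * m) j j<m ⟩
      ((x + q * m) C j) % p         ≡⟨ [x+qm]Cj≡xCj-mod-p q x j j<m ⟩
      (x C j) % p                   ∎
      where
      regroup : ∀ x m y → x + (m + y) ≡ x + y + m
      regroup = solve-∀

    -- The case of Lucas' theorem in which every base-p digit of m − 1 equals p − 1.
    p∣xCm′ : ∀ x → ¬ (m ∣ suc x) → p ∣ x C m′
    p∣xCm′ x m∤1+x = m%n≡0⇒n∣m (x C m′) p (begin
      (x C m′) % p                   ≡⟨ cong (λ y → (y C m′) % p) (m≡m%n+[m/n]*n x m) ⟩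
      ((x % m + x / m * m) C m′) % p ≡⟨ [x+qm]Cj≡xCj-mod-p (x / m) (x % m) m′ ≤-refl ⟩
      ((x % m) C m′) % p             ≡⟨ cong (_% p) (k>n⇒nCk≡0 x%m<m′) ⟩
      0 % p                          ≡⟨ m*n%n≡0 0 p ⟩
      0                              ∎)
      where
      x%m<m′ : x % m < m′
      x%m<m′ with m≤n⇒m<n∨m≡n (≤-pred (m%n<n x m))
      ... | inj₁ x%m<m′ = x%m<m′
      ... | inj₂ x%m≡m′ = ⊥-elim (m∤1+x (divides (suc (x / m)) (begin
        suc x                      ≡⟨ cong suc (m≡m%n+[m/n]*n x m) ⟩
        suc (x % m + x / m * m)    ≡⟨ cong (λ y → suc (y + x / m * m)) x%m≡m′ ⟩
        suc (x / m) * m            ∎)))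

module Sieve (N₀ : ℕ) where

  open import Data.Nat as ℕ using (ℕ; zero; suc; _≤_; _<_; z≤n; s≤s)
  import Data.Nat.Properties as ℕ
  open import Data.Nat.Divisibility
    using (_∣_; _∣?_; divides; quotient; ∣-trans; ∣⇒≤; ∣1⇒≡1; *-cancelˡ-∣; _∣0)
  open _∣_ using (equality)
  open import Data.Nat.GCD using (gcd; gcd[m,n]∣m; gcd[m,n]∣n; gcd-GCD; module Bézout)
  open import Data.Nat.ListAction using (product)
  open import Data.Nat.Primality using (Prime; prime?; euclidsLemma; prime⇒nonZero; ¬prime[0]; ¬prime[1])
  open import Data.Nat.Primality.Factorisation using (factorise)
  import Data.Nat.Tactic.RingSolver as ℕ-Solver
  open import Data.Integer as ℤ using (ℤ; +_; _+_; _*_; -_; _-_; 0ℤ; 1ℤ)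
  import Data.Integer.Properties as ℤ
  import Data.Integer.Divisibility.Signed as ℤ
  open import Data.Integer.Tactic.RingSolver using (solve-∀)
  open import Data.Bool using (if_then_else_)
  open import Data.List using (List; []; _∷_)
  open import Data.List.Relation.Unary.All as All using (All; []; _∷_)
  open import Data.List.Relation.Unary.Any as Any using (Any; here; there)
  open import Data.List.Relation.Unary.AllPairs using (AllPairs; []; _∷_)
  open import Data.Product using (∃; Σ; _×_; _,_)
  open import Data.Sum using (inj₁; inj₂)
  open import Data.Empty using (⊥-elim)
  open import Relation.Nullary using (¬_; Dec; yes; no; does)
  open import Relation.Nullary.Decidable using (_×-dec_)
  open import Relation.Binary.PropositionalEquality
  open ≡-Reasoning
  open SumsBelow using (sumBelow; sumBelow-cong; sumBelow-const; sumBelow-−; sumBelow-shift)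

  N : ℕ
  N = suc N₀

  N∣_ : ℤ → Set
  N∣ x = + N ℤ.∣ x

  N∣? : ∀ x → Dec (N∣ x)
  N∣? x with N ∣? ℤ.∣ x ∣
  ... | yes N∣x = yes (ℤ.∣ᵤ⇒∣ N∣x)
  ... | no N∤x = no (λ N∣x → N∤x (ℤ.∣⇒∣ᵤ N∣x))

  record PrimeFactor : Set where
    field
      prime cofactor : ℕ
      isPrime : Prime prime
      prime*cofactor≡N : prime ℕ.* cofactor ≡ N
  open PrimeFactor

  -- sieve L x = ∑_{T ⊆ L} (−1)^|T| [N ∣ x − ∑_{f ∈ T} N / prime f]
  sieve : List PrimeFactor → ℤ → ℤ
  sieve [] x = if does (N∣? x) then 1ℤ else 0ℤ
  sieve (f ∷ L) x = sieve L x - sieve L (x - + cofactor f)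

  sieve-periodic : ∀ L x {e} → N∣ e → sieve L (x + e) ≡ sieve L x
  sieve-periodic [] x {e} N∣e with N∣? (x + e) | N∣? x
  ... | yes _ | yes _ = refl
  ... | no _ | no _ = refl
  ... | yes N∣x+e | no N∤x = ⊥-elim (N∤x (subst N∣_ (cancel x e) (ℤ.∣m∣n⇒∣m-n N∣x+e N∣e)))
    where
    cancel : ∀ x e → x + e - e ≡ x
    cancel = solve-∀
  ... | no N∤x+e | yes N∣x = ⊥-elim (N∤x+e (ℤ.∣m∣n⇒∣m+n N∣x N∣e))
  sieve-periodic (f ∷ L) x {e} N∣e =
    cong₂ _-_ (sieve-periodic L x N∣e)
              (trans (cong (sieve L) (swap x e (+ cofactor f))) (sieve-periodic L (x - + cofactor f) N∣e))
    where
    swap : ∀ x e h → x + e - h ≡ x - h + e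
    swap = solve-∀

  primeProduct : List PrimeFactor → ℕ
  primeProduct [] = 1
  primeProduct (f ∷ L) = prime f ℕ.* primeProduct L

  sieve-vanishes : ∀ L x → ¬ N∣ (x * + primeProduct L) → sieve L x ≡ 0ℤ
  sieve-vanishes [] x N∤x with N∣? x
  ... | yes N∣x = ⊥-elim (N∤x (subst N∣_ (sym (ℤ.*-identityʳ x)) N∣x))
  ... | no _ = refl
  sieve-vanishes (f ∷ L) x N∤xqP = cong₂ _-_ (sieve-vanishes L x N∤xP) (sieve-vanishes L (x - + h) N∤[x-h]P)
    where
    q h P : ℕ
    q = prime f
    h = cofactor f
    P = primeProduct L
    +qP≡+q*+P : + (q ℕ.* P) ≡ + q * + P
    +qP≡+q*+P = ℤ.pos-* q P
    regroup : ∀ x q P → x * P * q ≡ x * (q * P)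
    regroup = solve-∀
    regroup′ : ∀ x h q P → (x - h) * P * q + q * h * P ≡ x * (q * P)
    regroup′ = solve-∀
    N∣qhP : N∣ (+ q * + h * + P)
    N∣qhP = subst (λ z → N∣ (z * + P)) (trans (cong +_ (sym (prime*cofactor≡N f))) (ℤ.pos-* q h))
                  (ℤ.∣m⇒∣m*n (+ P) ℤ.∣-refl)
    N∤xP : ¬ N∣ (x * + P)
    N∤xP N∣xP = N∤xqP (subst N∣_ (trans (regroup x (+ q) (+ P)) (cong (x *_) (sym +qP≡+q*+P)))
                                (ℤ.∣m⇒∣m*n (+ q) N∣xP))
    N∤[x-h]P : ¬ N∣ ((x - + h) * + P)
    N∤[x-h]P N∣[x-h]P = N∤xqP (subst N∣_ (trans (regroup′ x (+ h) (+ q) (+ P)) (cong (x *_) (sym +qP≡+q*+P)))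
                                      (ℤ.∣m∣n⇒∣m+n (ℤ.∣m⇒∣m*n (+ q) N∣[x-h]P) N∣qhP))

  prime∤primeProduct : ∀ {q} → Prime q → ∀ L → All (λ f → prime f < q) L → ¬ q ∣ primeProduct L
  prime∤primeProduct q-prime [] [] q∣1 = ¬prime[1] (subst Prime (∣1⇒≡1 q∣1) q-prime)
  prime∤primeProduct q-prime (f ∷ L) (f<q ∷ L<q) q∣fP with euclidsLemma (prime f) (primeProduct L) q-prime q∣fP
  ... | inj₁ q∣f = ℕ.<⇒≱ f<q (∣⇒≤ {{prime⇒nonZero (isPrime f)}} q∣f)
  ... | inj₂ q∣P = prime∤primeProduct q-prime L L<q q∣P

  Decreasing : List PrimeFactor → Set
  Decreasing = AllPairs (λ f g → prime g < prime f)

  sieve-0 : ∀ L → Decreasing L → sieve L 0ℤ ≡ 1ℤ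
  sieve-0 [] _ with N∣? 0ℤ
  ... | yes _ = refl
  ... | no N∤0 = ⊥-elim (N∤0 (ℤ.∣ᵤ⇒∣ (N ∣0)))
  sieve-0 (f ∷ L) (L<f ∷ decreasing) =
    cong₂ _-_ (sieve-0 L decreasing) (sieve-vanishes L (0ℤ - + cofactor f) N∤-hP)
    where
    h P : ℕ
    h = cofactor f
    P = primeProduct L
    instance
      h≢0 : ℕ.NonZero h
      h≢0 = ℕ.≢-nonZero (λ h≡0 → ℕ.1+n≢0 (trans (sym (prime*cofactor≡N f))
              (trans (cong (prime f ℕ.*_) h≡0) (ℕ.*-zeroʳ (prime f)))))
    ∣-hP∣≡hP : ℤ.∣ (0ℤ - + h) * + P ∣ ≡ h ℕ.* P
    ∣-hP∣≡hP = trans (ℤ.abs-* (0ℤ - + h) (+ P))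
                     (cong (ℕ._* P) (trans (cong ℤ.∣_∣ (ℤ.+-identityˡ (- + h))) (ℤ.∣-i∣≡∣i∣ (+ h))))
    N∤-hP : ¬ N∣ ((0ℤ - + h) * + P)
    N∤-hP N∣-hP = prime∤primeProduct (isPrime f) L L<f (*-cancelˡ-∣ h hq∣hP)
      where
      hq∣hP : h ℕ.* prime f ∣ h ℕ.* P
      hq∣hP = subst₂ _∣_ (trans (sym (prime*cofactor≡N f)) (ℕ.*-comm (prime f) h)) ∣-hP∣≡hP (ℤ.∣⇒∣ᵤ N∣-hP)

  sieveSum : List PrimeFactor → ℕ → ℤ → ℤ
  sieveSum L ρ κ = sumBelow N (λ y → sieve L (+ y * + ρ - κ))

  sieveSum-multiple : ∀ L {ρ} → N∣ (+ ρ) → ∀ κ → sieveSum L ρ κ ≡ + N * sieve L (- κ)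
  sieveSum-multiple L {ρ} N∣ρ κ = trans (sumBelow-cong N constant) (sumBelow-const N (sieve L (- κ)))
    where
    swap : ∀ a κ → a - κ ≡ - κ + a
    swap = solve-∀
    constant : ∀ y → sieve L (+ y * + ρ - κ) ≡ sieve L (- κ)
    constant y = trans (cong (sieve L) (swap (+ y * + ρ) κ)) (sieve-periodic L (- κ) (ℤ.∣n⇒∣m*n (+ y) N∣ρ))

  _∈⟨_⟩ : PrimeFactor → ℕ → Set
  f ∈⟨ ρ ⟩ = ∃ λ u → N∣ (+ u * + ρ + + cofactor f)

  -- Shifting the summation index by u turns the subtracted half of the sum into the other half.
  sieveSum-vanishes : ∀ L {ρ} → Any (_∈⟨ ρ ⟩) L → ∀ κ → sieveSum L ρ κ ≡ 0ℤ
  sieveSum-vanishes (f ∷ L) {ρ} (here (u , N∣uρ+h)) κ = begin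
    sumBelow N (λ y → F y - sieve L (+ y * + ρ - κ - + h))
      ≡⟨ sumBelow-− N F (λ y → sieve L (+ y * + ρ - κ - + h)) ⟩
    sumBelow N F - sumBelow N (λ y → sieve L (+ y * + ρ - κ - + h))
      ≡⟨ cong (_-_ (sumBelow N F)) (sumBelow-cong N shifted) ⟩
    sumBelow N F - sumBelow N (λ y → F (y ℕ.+ u))
      ≡⟨ cong (_-_ (sumBelow N F)) (sumBelow-shift N F F-periodic u) ⟩
    sumBelow N F - sumBelow N F
      ≡⟨ ℤ.+-inverseʳ (sumBelow N F) ⟩
    0ℤ ∎
    where
    h : ℕ
    h = cofactor f
    F : ℕ → ℤ
    F y = sieve L (+ y * + ρ - κ)
    F-periodic : ∀ y → F (y ℕ.+ N) ≡ F y
    F-periodic y = trans (cong (sieve L) (regroup (+ y) (+ N) (+ ρ) κ))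
                         (sieve-periodic L (+ y * + ρ - κ) (ℤ.∣m⇒∣m*n (+ ρ) ℤ.∣-refl))
      where
      regroup : ∀ y N ρ κ → (y + N) * ρ - κ ≡ y * ρ - κ + N * ρ
      regroup = solve-∀
    shifted : ∀ y → sieve L (+ y * + ρ - κ - + h) ≡ F (y ℕ.+ u)
    shifted y = sym (trans (cong (sieve L) (regroup (+ y) (+ u) (+ ρ) κ (+ h)))
                           (sieve-periodic L (+ y * + ρ - κ - + h) N∣uρ+h))
      where
      regroup : ∀ y u ρ κ h → (y + u) * ρ - κ ≡ y * ρ - κ - h + (u * ρ + h)
      regroup = solve-∀
  sieveSum-vanishes (f ∷ L) {ρ} (there f′∈⟨ρ⟩) κ = begin
    sumBelow N (λ y → sieve L (+ y * + ρ - κ) - sieve L (+ y * + ρ - κ - + cofactor f))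
      ≡⟨ sumBelow-− N (λ y → sieve L (+ y * + ρ - κ)) (λ y → sieve L (+ y * + ρ - κ - + cofactor f)) ⟩
    sieveSum L ρ κ - sumBelow N (λ y → sieve L (+ y * + ρ - κ - + cofactor f))
      ≡⟨ cong₂ _-_ (sieveSum-vanishes L f′∈⟨ρ⟩ κ)
                   (trans (sumBelow-cong N (λ y → cong (sieve L) (regroup (+ y * + ρ) κ (+ cofactor f))))
                          (sieveSum-vanishes L f′∈⟨ρ⟩ (κ + + cofactor f))) ⟩
    0ℤ ∎
    where
    regroup : ∀ a κ h → a - κ - h ≡ a - (κ + h)
    regroup = solve-∀

  Complete : List PrimeFactor → Set
  Complete L = ∀ {q} → Prime q → q ∣ N → Any (λ f → prime f ≡ q) L

  primeFactors≤ : ∀ b → Σ (List PrimeFactor) λ L → Decreasing L × All (λ f → prime f ≤ b) L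
                    × (∀ {q} → Prime q → q ∣ N → q ≤ b → Any (λ f → prime f ≡ q) L)
  primeFactors≤ zero = [] , [] , [] , λ { q-prime _ z≤n → ⊥-elim (¬prime[0] q-prime) }
  primeFactors≤ (suc b) with primeFactors≤ b | prime? (suc b) ×-dec suc b ∣? N
  ... | L , decreasing , L≤b , complete | yes (b+1-prime , divides h N≡h*[b+1]) =
    f ∷ L , All.map s≤s L≤b ∷ decreasing , ℕ.≤-refl ∷ All.map ℕ.m≤n⇒m≤1+n L≤b , complete′
    where
    f : PrimeFactor
    f = record { prime = suc b ; cofactor = h ; isPrime = b+1-prime
               ; prime*cofactor≡N = trans (ℕ.*-comm (suc b) h) (sym N≡h*[b+1]) }
    complete′ : ∀ {q} → Prime q → q ∣ N → q ≤ suc b → Any (λ f → prime f ≡ q) (f ∷ L)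
    complete′ q-prime q∣N q≤b+1 with ℕ.m≤n⇒m<n∨m≡n q≤b+1
    ... | inj₁ (s≤s q≤b) = there (complete q-prime q∣N q≤b)
    ... | inj₂ refl = here refl
  ... | L , decreasing , L≤b , complete | no ¬[b+1-prime×b+1∣N] =
    L , decreasing , All.map ℕ.m≤n⇒m≤1+n L≤b , complete′
    where
    complete′ : ∀ {q} → Prime q → q ∣ N → q ≤ suc b → Any (λ f → prime f ≡ q) L
    complete′ q-prime q∣N q≤b+1 with ℕ.m≤n⇒m<n∨m≡n q≤b+1
    ... | inj₁ (s≤s q≤b) = complete q-prime q∣N q≤b
    ... | inj₂ refl = ⊥-elim (¬[b+1-prime×b+1∣N] (q-prime , q∣N))

  primeFactors : Σ (List PrimeFactor) λ L → Decreasing L × Complete L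
  primeFactors with primeFactors≤ N
  ... | L , decreasing , _ , complete = L , decreasing , λ q-prime q∣N → complete q-prime q∣N (∣⇒≤ q∣N)

  gcd∣h⇒∃u[N∣uρ+h] : ∀ ρ h → gcd ρ N ∣ h → ∃ λ u → N ∣ u ℕ.* ρ ℕ.+ h
  gcd∣h⇒∃u[N∣uρ+h] ρ .(s ℕ.* gcd ρ N) (divides s refl) with Bézout.identity (gcd-GCD ρ N)
  ... | Bézout.+- x y d+yN≡xρ = x ℕ.* s ℕ.* N₀ , divides (s ℕ.* d ℕ.+ s ℕ.* N₀ ℕ.* y) (begin
    x ℕ.* s ℕ.* N₀ ℕ.* ρ ℕ.+ s ℕ.* d       ≡⟨ regroup x s N₀ ρ d ⟩
    s ℕ.* N₀ ℕ.* (x ℕ.* ρ) ℕ.+ s ℕ.* d     ≡⟨ cong (λ z → s ℕ.* N₀ ℕ.* z ℕ.+ s ℕ.* d) d+yN≡xρ ⟨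
    s ℕ.* N₀ ℕ.* (d ℕ.+ y ℕ.* N) ℕ.+ s ℕ.* d ≡⟨ regroup′ s N₀ d y ⟩
    (s ℕ.* d ℕ.+ s ℕ.* N₀ ℕ.* y) ℕ.* N     ∎)
    where
    d : ℕ
    d = gcd ρ N
    regroup : ∀ x s N₀ ρ d → x ℕ.* s ℕ.* N₀ ℕ.* ρ ℕ.+ s ℕ.* d ≡ s ℕ.* N₀ ℕ.* (x ℕ.* ρ) ℕ.+ s ℕ.* d
    regroup = ℕ-Solver.solve-∀
    regroup′ : ∀ s N₀ d y →
      s ℕ.* N₀ ℕ.* (d ℕ.+ y ℕ.* suc N₀) ℕ.+ s ℕ.* d ≡ (s ℕ.* d ℕ.+ s ℕ.* N₀ ℕ.* y) ℕ.* suc N₀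
    regroup′ = ℕ-Solver.solve-∀
  ... | Bézout.-+ x y d+xρ≡yN = x ℕ.* s , divides (s ℕ.* y) (begin
    x ℕ.* s ℕ.* ρ ℕ.+ s ℕ.* d   ≡⟨ regroup x s ρ d ⟩
    s ℕ.* (d ℕ.+ x ℕ.* ρ)       ≡⟨ cong (s ℕ.*_) d+xρ≡yN ⟩
    s ℕ.* (y ℕ.* N)             ≡⟨ ℕ.*-assoc s y N ⟨
    s ℕ.* y ℕ.* N               ∎)
    where
    d : ℕ
    d = gcd ρ N
    regroup : ∀ x s ρ d → x ℕ.* s ℕ.* ρ ℕ.+ s ℕ.* d ≡ s ℕ.* (d ℕ.+ x ℕ.* ρ)
    regroup = ℕ-Solver.solve-∀

  ∃prime∣ : ∀ c .{{_ : ℕ.NonZero c}} → c ≢ 1 → ∃ λ q → Prime q × q ∣ c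
  ∃prime∣ c c≢1 with factorise c
  ... | record { factors = [] ; isFactorisation = c≡1 } = ⊥-elim (c≢1 c≡1)
  ... | record { factors = q ∷ qs ; isFactorisation = c≡q*qs ; factorsPrime = q-prime ∷ _ } =
    q , q-prime , divides (product qs) (trans c≡q*qs (ℕ.*-comm q (product qs)))

  q∣N/d⇒d∣N/q : ∀ {q c d h} → Prime q → N ≡ c ℕ.* d → q ∣ c → q ℕ.* h ≡ N → d ∣ h
  q∣N/d⇒d∣N/q {q} {c} {d} {h} q-prime N≡cd (divides s c≡sq) q*h≡N =
    divides s (ℕ.*-cancelˡ-≡ h (s ℕ.* d) q {{prime⇒nonZero q-prime}} (begin
      q ℕ.* h           ≡⟨ q*h≡N ⟩
      N                 ≡⟨ N≡cd ⟩
      c ℕ.* d           ≡⟨ cong (ℕ._* d) c≡sq ⟩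
      s ℕ.* q ℕ.* d     ≡⟨ regroup s q d ⟩
      q ℕ.* (s ℕ.* d)   ∎))
    where
    regroup : ∀ s q d → s ℕ.* q ℕ.* d ≡ q ℕ.* (s ℕ.* d)
    regroup = ℕ-Solver.solve-∀

  ∃prime∣N/gcd : ∀ ρ → ¬ N ∣ ρ → ∃ λ q → Prime q × q ∣ N × (∀ h → q ℕ.* h ≡ N → gcd ρ N ∣ h)
  ∃prime∣N/gcd ρ N∤ρ = extend (∃prime∣ c c≢1)
    where
    d c : ℕ
    d = gcd ρ N
    c = quotient (gcd[m,n]∣n ρ N)
    N≡cd : N ≡ c ℕ.* d
    N≡cd = equality (gcd[m,n]∣n ρ N)
    c≢1 : c ≢ 1
    c≢1 c≡1 = N∤ρ (subst (_∣ ρ) (sym (trans N≡cd (trans (cong (ℕ._* d) c≡1) (ℕ.*-identityˡ d))))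
                         (gcd[m,n]∣m ρ N))
    instance
      c≢0 : ℕ.NonZero c
      c≢0 = ℕ.m*n≢0⇒m≢0 c {{subst ℕ.NonZero N≡cd _}}
    extend : (∃ λ q → Prime q × q ∣ c) → ∃ λ q → Prime q × q ∣ N × (∀ h → q ℕ.* h ≡ N → d ∣ h)
    extend (q , q-prime , q∣c) =
      q , q-prime , ∣-trans q∣c (divides d (trans N≡cd (ℕ.*-comm c d))) , λ h → q∣N/d⇒d∣N/q q-prime N≡cd q∣c

  ∈⟨⟩-witness : ∀ L → Complete L → ∀ {ρ} → ¬ N ∣ ρ → Any (_∈⟨ ρ ⟩) L
  ∈⟨⟩-witness L complete {ρ} N∤ρ with ∃prime∣N/gcd ρ N∤ρ
  ... | q , q-prime , q∣N , gcd∣cofactor = Any.map (λ {f} → cofactor∈⟨ρ⟩ {f}) (complete q-prime q∣N)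
    where
    cofactor∈⟨ρ⟩ : ∀ {f} → prime f ≡ q → f ∈⟨ ρ ⟩
    cofactor∈⟨ρ⟩ {f} refl
      with gcd∣h⇒∃u[N∣uρ+h] ρ (cofactor f) (gcd∣cofactor (cofactor f) (prime*cofactor≡N f))
    ... | u , N∣uρ+h =
      u , subst N∣_ (trans (ℤ.pos-+ (u ℕ.* ρ) (cofactor f)) (cong (_+ + cofactor f) (ℤ.pos-* u ρ)))
                    (ℤ.∣ᵤ⇒∣ N∣uρ+h)

module ZeroSum {p e} (p-prime : Prime p) (m′ : ℕ) (m≡p^e : suc m′ ≡ p ^ e) (N₀ : ℕ) where

  open import Data.Nat as ℕ using (suc; _≤_; _!)
  import Data.Nat.Properties as ℕ
  open import Data.Nat.Divisibility using (_∣_; _∣?_; _∣0; ∣-refl; ∣1⇒≡1; ∣m+n∣m⇒∣n; *-monoˡ-∣)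
  open import Data.Nat.DivMod using (_/_; m*[n/m]≡n; m/n*n≡m)
  open import Data.Nat.Combinatorics using (_C_; nCn≡1)
  open import Data.Integer as ℤ using (ℤ; +_; _*_; -_; _-_; 0ℤ; 1ℤ)
  import Data.Integer.Properties as ℤ
  import Data.Integer.Divisibility.Signed as ℤ
  open import Data.Integer.Tactic.RingSolver using (solve-∀)
  open import Data.Fin using (Fin)
  open import Data.Fin.Subset using (Subset; Nonempty; _∈_; ∣_∣) renaming (⊥ to ∅)
  open import Data.Fin.Subset.Properties using (anySubset?; nonempty?)
  open import Data.List using (List)
  open import Data.Nat.Primality using (¬prime[1])
  open import Data.Product using (∃; _×_; _,_; proj₁; proj₂)
  open import Data.Sum using (inj₁; inj₂)
  open import Data.Empty using (⊥; ⊥-elim)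
  open import Relation.Nullary using (¬_; yes; no)
  open import Relation.Nullary.Decidable using (_×-dec_)
  open import Relation.Binary.PropositionalEquality
  open ≡-Reasoning
  open SubsetSums
  open SumsOverSubsets
  open SumsBelow
  open FiniteDifferences using (rising; Degree<-rising)
  open AlternatingSums using (alternatingSum-vanishes)
  open Binomials using (rising-eval)
  open PrimePowerBinomials using (p∣xCm′)
  open Sieve N₀

  private
    m : ℕ
    m = suc m′

  module Contradiction {k} (r : Fin k → ℕ) (c : Fin k → ℤ) (T : ℕ → Subset k)
    (T-large : ∀ y → m ≤ ∣ T y ∣) (T-periods : ∀ y {s} → s ∈ T y → N∣ (+ y * + r s - c s))
    (no-zero-sum : ∀ I → Nonempty I → ¬ m ℕ.* N ∣ subsetSumℕ I r) where

    L : List PrimeFactor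
    L = proj₁ primeFactors

    L-decreasing : Decreasing L
    L-decreasing = proj₁ (proj₂ primeFactors)

    L-complete : Complete L
    L-complete = proj₂ (proj₂ primeFactors)

    ρ : Subset k → ℕ
    ρ I = subsetSumℕ I r

    κ : Subset k → ℤ
    κ I = subsetSumℤ I c

    f : ℤ → ℤ
    f = rising N m′

    vanishes-at : ∀ y → sumOverSubsets (λ I → sign I * f (+ ρ I) * sieve L (+ y * + ρ I - κ I)) ≡ 0ℤ
    vanishes-at y = trans (sumOverSubsets-cong term)
      (alternatingSum-vanishes (T y) {λ s → + r s} {λ s → + y * + r s - c s} {f = f} {sieve L}
        (Degree<-rising N m′) (λ s∈T x → sieve-periodic L x (T-periods y s∈T)) (T-large y))
      where
      term : ∀ I → sign I * f (+ ρ I) * sieve L (+ y * + ρ I - κ I)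
                 ≡ sign I * f (subsetSumℤ I (λ s → + r s)) * sieve L (subsetSumℤ I (λ s → + y * + r s - c s))
      term I rewrite subsetSumℤ-linear I (+ y) (λ s → + r s) c | subsetSumℤ-pos I r = refl

    vanishes : sumOverSubsets (λ I → sign I * f (+ ρ I) * sieveSum L (ρ I) (κ I)) ≡ 0ℤ
    vanishes = begin
      sumOverSubsets (λ I → sign I * f (+ ρ I) * sieveSum L (ρ I) (κ I))
        ≡⟨ sumOverSubsets-cong (λ I → sumBelow-*ˡ N (sign I * f (+ ρ I)) (λ y → sieve L (+ y * + ρ I - κ I))) ⟨
      sumOverSubsets (λ I → sumBelow N (λ y → sign I * f (+ ρ I) * sieve L (+ y * + ρ I - κ I)))
        ≡⟨ sumBelow-sumOverSubsets N (λ y I → sign I * f (+ ρ I) * sieve L (+ y * + ρ I - κ I)) ⟨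
      sumBelow N (λ y → sumOverSubsets (λ I → sign I * f (+ ρ I) * sieve L (+ y * + ρ I - κ I)))
        ≡⟨ sumBelow-cong N vanishes-at ⟩
      sumBelow N (λ _ → 0ℤ)
        ≡⟨ trans (sumBelow-const N 0ℤ) (ℤ.*-zeroʳ (+ N)) ⟩
      0ℤ ∎

    normalised : Subset k → ℤ
    normalised I with N ∣? ρ I
    ... | yes _ = sign I * + ((ρ I / N ℕ.+ m′) C m′) * sieve L (- κ I)
    ... | no _ = 0ℤ

    K : ℤ
    K = + (N ℕ.^ m′ ℕ.* m′ ! ℕ.* N)

    term≡K*normalised : ∀ I → sign I * f (+ ρ I) * sieveSum L (ρ I) (κ I) ≡ K * normalised I
    term≡K*normalised I with N ∣? ρ I
    ... | no N∤ρ = begin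
      sign I * f (+ ρ I) * sieveSum L (ρ I) (κ I)
        ≡⟨ cong (sign I * f (+ ρ I) *_) (sieveSum-vanishes L (∈⟨⟩-witness L L-complete N∤ρ) (κ I)) ⟩
      sign I * f (+ ρ I) * 0ℤ
        ≡⟨ ℤ.*-zeroʳ (sign I * f (+ ρ I)) ⟩
      0ℤ
        ≡⟨ ℤ.*-zeroʳ K ⟨
      K * 0ℤ ∎
    ... | yes N∣ρ = begin
      sign I * f (+ ρ I) * sieveSum L (ρ I) (κ I)
        ≡⟨ cong (sign I * f (+ ρ I) *_) (sieveSum-multiple L (ℤ.∣ᵤ⇒∣ N∣ρ) (κ I)) ⟩
      sign I * f (+ ρ I) * (+ N * sieve L (- κ I))
        ≡⟨ cong (λ z → sign I * f (+ z) * (+ N * sieve L (- κ I))) (m*[n/m]≡n N∣ρ) ⟨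
      sign I * f (+ (N ℕ.* R)) * (+ N * sieve L (- κ I))
        ≡⟨ cong (λ z → sign I * z * (+ N * sieve L (- κ I))) (rising-eval N m′ R) ⟩
      sign I * + (N ℕ.^ m′ ℕ.* (m′ ! ℕ.* B)) * (+ N * sieve L (- κ I))
        ≡⟨ cong (λ z → sign I * z * (+ N * sieve L (- κ I))) +[N^m′*[m′!*B]]≡+N^m′*[+m′!*+B] ⟩
      sign I * (+ (N ℕ.^ m′) * (+ (m′ !) * + B)) * (+ N * sieve L (- κ I))
        ≡⟨ regroup (sign I) (+ (N ℕ.^ m′)) (+ (m′ !)) (+ B) (+ N) (sieve L (- κ I)) ⟩
      + (N ℕ.^ m′) * + (m′ !) * + N * (sign I * + B * sieve L (- κ I))
        ≡⟨ cong (_* (sign I * + B * sieve L (- κ I))) K≡+N^m′*+m′!*+N ⟨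
      K * (sign I * + B * sieve L (- κ I)) ∎
      where
      R B : ℕ
      R = ρ I / N
      B = (R ℕ.+ m′) C m′
      +[N^m′*[m′!*B]]≡+N^m′*[+m′!*+B] : + (N ℕ.^ m′ ℕ.* (m′ ! ℕ.* B)) ≡ + (N ℕ.^ m′) * (+ (m′ !) * + B)
      +[N^m′*[m′!*B]]≡+N^m′*[+m′!*+B] = trans (ℤ.pos-* (N ℕ.^ m′) _) (cong (+ (N ℕ.^ m′) *_) (ℤ.pos-* (m′ !) B))
      K≡+N^m′*+m′!*+N : K ≡ + (N ℕ.^ m′) * + (m′ !) * + N
      K≡+N^m′*+m′!*+N = trans (ℤ.pos-* (N ℕ.^ m′ ℕ.* m′ !) N) (cong (_* + N) (ℤ.pos-* (N ℕ.^ m′) (m′ !)))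
      regroup : ∀ s P F B N S → s * (P * (F * B)) * (N * S) ≡ P * F * N * (s * B * S)
      regroup = solve-∀

    K≢0 : K ≢ 0ℤ
    K≢0 K≡0 = ℕ.≢-nonZero⁻¹ (N ℕ.^ m′ ℕ.* m′ ! ℕ.* N) {{K≢0ℕ}} (ℤ.+-injective K≡0)
      where
      instance
        N^m′≢0 : ℕ.NonZero (N ℕ.^ m′)
        N^m′≢0 = ℕ.m^n≢0 N m′
        m′!≢0 : ℕ.NonZero (m′ !)
        m′!≢0 = m′ ℕ.!≢0
        N^m′*m′!≢0 : ℕ.NonZero (N ℕ.^ m′ ℕ.* m′ !)
        N^m′*m′!≢0 = ℕ.m*n≢0 (N ℕ.^ m′) (m′ !)
        K≢0ℕ : ℕ.NonZero (N ℕ.^ m′ ℕ.* m′ ! ℕ.* N)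
        K≢0ℕ = ℕ.m*n≢0 (N ℕ.^ m′ ℕ.* m′ !) N

    K*normalised-vanishes : K * sumOverSubsets normalised ≡ 0ℤ
    K*normalised-vanishes = begin
      K * sumOverSubsets normalised
        ≡⟨ sumOverSubsets-*ˡ K normalised ⟨
      sumOverSubsets (λ I → K * normalised I)
        ≡⟨ sumOverSubsets-cong term≡K*normalised ⟨
      sumOverSubsets (λ I → sign I * f (+ ρ I) * sieveSum L (ρ I) (κ I))
        ≡⟨ vanishes ⟩
      0ℤ ∎

    normalised-vanishes : sumOverSubsets normalised ≡ 0ℤ
    normalised-vanishes with ℤ.i*j≡0⇒i≡0∨j≡0 K K*normalised-vanishes
    ... | inj₁ K≡0 = ⊥-elim (K≢0 K≡0)
    ... | inj₂ sum≡0 = sum≡0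

    normalised-∅ : normalised ∅ ≡ 1ℤ
    normalised-∅ with N ∣? ρ ∅
    ... | no N∤ρ∅ = ⊥-elim (N∤ρ∅ (subst (N ∣_) (sym (subsetSumℕ-∅ r)) (N ∣0)))
    ... | yes _ rewrite subsetSumℕ-∅ r | subsetSumℤ-∅ c | sign-∅ k | sieve-0 L L-decreasing | nCn≡1 m′ = refl

    p∣normalised : ∀ I → Nonempty I → + p ℤ.∣ normalised I
    p∣normalised I I≢∅ with N ∣? ρ I
    ... | no _ = ℤ.∣ᵤ⇒∣ (p ∣0)
    ... | yes N∣ρ = ℤ.∣m⇒∣m*n (sieve L (- κ I)) (ℤ.∣n⇒∣m*n (sign I) (ℤ.∣ᵤ⇒∣ p∣B))
      where
      R : ℕ
      R = ρ I / N
      m∤R+m : ¬ m ∣ suc (R ℕ.+ m′)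
      m∤R+m m∣R+m = no-zero-sum I I≢∅ (subst (m ℕ.* N ∣_) (m/n*n≡m N∣ρ)
        (*-monoˡ-∣ N (∣m+n∣m⇒∣n (subst (m ∣_) (trans (sym (ℕ.+-suc R m′)) (ℕ.+-comm R m)) m∣R+m) (∣-refl {m}))))
      p∣B : p ∣ (R ℕ.+ m′) C m′
      p∣B = p∣xCm′ {e = e} p-prime m′ m≡p^e (R ℕ.+ m′) m∤R+m

    contradiction : ⊥
    contradiction = ¬prime[1] (subst Prime (∣1⇒≡1 p∣1) p-prime)
      where
      p∣1 : p ∣ 1
      p∣1 = ℤ.∣⇒∣ᵤ (subst (+ p ℤ.∣_) (cong₂ _-_ normalised-vanishes normalised-∅)
                          (∣-sumOverSubsets-nonempty normalised p∣normalised))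

  zeroSum : ∀ {k} (r : Fin k → ℕ) (c : Fin k → ℤ) (T : ℕ → Subset k) →
    (∀ y → m ≤ ∣ T y ∣) → (∀ y {s} → s ∈ T y → N∣ (+ y * + r s - c s)) →
    ∃ λ I → Nonempty I × m ℕ.* N ∣ subsetSumℕ I r
  zeroSum r c T T-large T-periods with anySubset? (λ I → nonempty? I ×-dec (m ℕ.* N ∣? subsetSumℕ I r))
  ... | yes zero-sum = zero-sum
  ... | no ¬zero-sum = ⊥-elim (Contradiction.contradiction r c T T-large T-periods
                                 (λ I I≢∅ mN∣ρ → ¬zero-sum (I , I≢∅ , mN∣ρ)))

module Covers where

  open import Data.Nat as ℕ using (zero; _*_; _≤_; NonZero)
  import Data.Nat.Properties as ℕ
  open import Data.Nat.Divisibility using (_∣_)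
  open import Data.Nat.Tactic.RingSolver using (solve-∀)
  open import Data.Integer as ℤ using (ℤ; +_; _-_)
  import Data.Integer.Properties as ℤ
  import Data.Integer.Divisibility.Signed as ℤ
  import Data.Integer.Tactic.RingSolver as ℤ-Solver
  open import Data.Fin using (Fin; zero; suc)
  open import Data.Fin.Subset using (Subset; Nonempty; _∈_; ∣_∣)
  open import Data.Vec using (tabulate)
  open import Data.Vec.Properties using ([]=⇒lookup; lookup∘tabulate)
  import Data.List as List
  open import Data.Bool using (true; false)
  open import Data.Product using (∃; _×_; _,_)
  open import Function using (_∘_)
  open import Relation.Nullary using (yes; no; does)
  open import Relation.Unary using (Pred; Decidable)
  open import Relation.Binary.PropositionalEquality
  open ≡-Reasoning
  open SubsetSums using (subsetSumℕ)

  ∏ : ∀ {k} → (Fin k → ℕ) → ℕ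
  ∏ {zero} n = 1
  ∏ {suc k} n = n zero * ∏ (n ∘ suc)

  cofactor : ∀ {k} → (Fin k → ℕ) → Fin k → ℕ
  cofactor n zero = ∏ (n ∘ suc)
  cofactor n (suc s) = n zero * cofactor (n ∘ suc) s

  n*cofactor≡∏ : ∀ {k} (n : Fin k → ℕ) s → n s * cofactor n s ≡ ∏ n
  n*cofactor≡∏ n zero = refl
  n*cofactor≡∏ n (suc s) =
    trans (swap (n (suc s)) (n zero) (cofactor (n ∘ suc) s)) (cong (n zero *_) (n*cofactor≡∏ (n ∘ suc) s))
    where
    swap : ∀ a b c → a * (b * c) ≡ b * (a * c)
    swap = solve-∀

  ∏-nonZero : ∀ {k} (n : Fin k → ℕ) → (∀ s → NonZero (n s)) → NonZero (∏ n)
  ∏-nonZero {zero} n nz = _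
  ∏-nonZero {suc k} n nz = ℕ.m*n≢0 (n zero) (∏ (n ∘ suc)) {{nz zero}} {{∏-nonZero (n ∘ suc) (nz ∘ suc)}}

  cofactor-nonZero : ∀ {k} (n : Fin k → ℕ) → (∀ s → NonZero (n s)) → ∀ s → NonZero (cofactor n s)
  cofactor-nonZero n nz s =
    ℕ.m*n≢0⇒n≢0 (n s) {{subst NonZero (sym (n*cofactor≡∏ n s)) (∏-nonZero n nz)}}

  length-filter≡∣tabulate∣ : ∀ {a} {A : Set a} {P : Pred A a} (P? : Decidable P) {k} (g : Fin k → A) →
    List.length (List.filter P? (List.tabulate g)) ≡ ∣ tabulate (λ s → does (P? (g s))) ∣
  length-filter≡∣tabulate∣ P? {zero} g = refl
  length-filter≡∣tabulate∣ P? {suc k} g with does (P? (g zero))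
  ... | true = cong suc (length-filter≡∣tabulate∣ P? (g ∘ suc))
  ... | false = length-filter≡∣tabulate∣ P? (g ∘ suc)

  covering : ∀ {k} → ℤ → (Fin k → ℤ) → (Fin k → ℕ) → Subset k
  covering x a n = tabulate (λ s → does (x ∈Res? a s , n s))

  weight≡∣covering∣ : ∀ k a n x → weight k a n x ≡ ∣ covering x a n ∣
  weight≡∣covering∣ k a n x = length-filter≡∣tabulate∣ (λ s → x ∈Res? a s , n s) (λ s → s)

  ∈covering⇒∈Res : ∀ {k} {x a n} {s : Fin k} → s ∈ covering x a n → x ∈Res a s , n s
  ∈covering⇒∈Res {x = x} {a} {n} {s} s∈covering
    with x ∈Res? a s , n s | trans (sym (lookup∘tabulate _ s)) ([]=⇒lookup s∈covering)
  ... | yes x∈Res | _ = x∈Res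
  ... | no _ | ()

  covering-periods : ∀ {k} (a : Fin k → ℤ) (n w : Fin k → ℕ) y {s} → s ∈ covering (+ y) a n →
    + ∏ n ℤ.∣ + y ℤ.* + (w s * cofactor n s) - a s ℤ.* + (w s * cofactor n s)
  covering-periods a n w y {s} s∈covering
    with ℤ.∣ᵤ⇒∣ {+ n s} {+ y - a s} (∈covering⇒∈Res {x = + y} {a} {n} s∈covering)
  ... | ℤ.divides t y-a≡tn = ℤ.divides (t ℤ.* + w s) (begin
    + y ℤ.* + (w s * cofactor n s) - a s ℤ.* + (w s * cofactor n s)
      ≡⟨ factor (+ y) (a s) (+ (w s * cofactor n s)) ⟩
    (+ y - a s) ℤ.* + (w s * cofactor n s)
      ≡⟨ cong₂ ℤ._*_ y-a≡tn (ℤ.pos-* (w s) (cofactor n s)) ⟩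
    t ℤ.* + n s ℤ.* (+ w s ℤ.* + cofactor n s)
      ≡⟨ regroup t (+ n s) (+ w s) (+ cofactor n s) ⟩
    t ℤ.* + w s ℤ.* (+ n s ℤ.* + cofactor n s)
      ≡⟨ cong (t ℤ.* + w s ℤ.*_) (trans (sym (ℤ.pos-* (n s) (cofactor n s))) (cong +_ (n*cofactor≡∏ n s))) ⟩
    t ℤ.* + w s ℤ.* + ∏ n ∎)
    where
    factor : ∀ y a r → y ℤ.* r - a ℤ.* r ≡ (y - a) ℤ.* r
    factor = ℤ-Solver.solve-∀
    regroup : ∀ t n w c → t ℤ.* n ℤ.* (w ℤ.* c) ≡ t ℤ.* w ℤ.* (n ℤ.* c)
    regroup = ℤ-Solver.solve-∀

  cover-zeroSum : ∀ {p e} → Prime p → ∀ m′ → suc m′ ≡ p ^ e → ∀ {k} (a : Fin k → ℤ) (n : Fin k → ℕ) →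
    (∀ s → NonZero (n s)) → IsCover (suc m′) k a n → (w : Fin k → ℕ) →
    ∃ λ I → Nonempty I × suc m′ * ∏ n ∣ subsetSumℕ I (λ s → w s * cofactor n s)
  cover-zeroSum {e = e} p-prime m′ m≡p^e {k} a n nz cover w =
    replace-N (ZeroSum.zeroSum {e = e} p-prime m′ m≡p^e N₀ r (λ s → a s ℤ.* + r s)
      (λ y → covering (+ y) a n)
      (λ y → subst (suc m′ ≤_) (weight≡∣covering∣ k a n (+ y)) (cover (+ y)))
      (λ y {s} s∈covering → subst (λ N → + N ℤ.∣ + y ℤ.* + r s - a s ℤ.* + r s) (sym N≡∏)
                                  (covering-periods a n w y s∈covering)))
    where
    N₀ : ℕ
    N₀ = ℕ.pred (∏ n)
    N≡∏ : suc N₀ ≡ ∏ n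
    N≡∏ = ℕ.suc-pred (∏ n) {{∏-nonZero n nz}}
    r : Fin k → ℕ
    r s = w s * cofactor n s
    replace-N : (∃ λ I → Nonempty I × suc m′ * suc N₀ ∣ subsetSumℕ I r) →
                ∃ λ I → Nonempty I × suc m′ * ∏ n ∣ subsetSumℕ I r
    replace-N (I , I≢∅ , m*N∣ρ) = I , I≢∅ , subst (λ N → suc m′ * N ∣ subsetSumℕ I r) N≡∏ m*N∣ρ

module Rationals where

  open import Data.Nat as ℕ using (zero; NonZero; pred)
  import Data.Nat.Properties as ℕ
  open import Data.Integer as ℤ using (ℤ; +_; _+_; _*_; -_; _-_)
  import Data.Integer.Properties as ℤ
  open import Data.Integer.Tactic.RingSolver using (solve-∀)
  open import Data.Rational as ℚ using (ℚ; 0ℚ; toℚᵘ)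
  import Data.Rational.Properties as ℚ
  open import Data.Rational.Unnormalised as ℚᵘ using (mkℚᵘ; *≡*) renaming (_≃_ to _≃ᵘ_)
  import Data.Rational.Unnormalised.Properties as ℚᵘ
  open import Data.Fin using (Fin; zero; suc)
  open import Data.Fin.Subset using (Subset; inside; outside)
  open import Data.Vec using ([]; _∷_; lookup)
  open import Data.List using (foldr)
  open import Data.List.Properties using (map-tabulate)
  open import Data.Bool using (if_then_else_)
  open import Function using (_∘_; id)
  open import Relation.Binary.PropositionalEquality
  open SubsetSums using (subsetSumℤ)
  open Covers using (∏; cofactor; n*cofactor≡∏; ∏-nonZero)

  subsetSum-∷ : ∀ {k} b (I : Subset k) (f : Fin (suc k) → ℚ) →
    subsetSum (b ∷ I) f ≡ (if b then f zero else 0ℚ) ℚ.+ subsetSum I (f ∘ suc)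
  subsetSum-∷ b I f = cong (λ xs → (if b then f zero else 0ℚ) ℚ.+ foldr ℚ._+_ 0ℚ xs)
    (trans (map-tabulate suc g) (sym (map-tabulate id (g ∘ suc))))
    where
    g : Fin (suc _) → ℚ
    g s = if lookup (b ∷ I) s then f s else 0ℚ

  toℚᵘ-/ : ∀ x n .{{_ : NonZero n}} → toℚᵘ (x ℚ./ n) ≃ᵘ mkℚᵘ x (pred n)
  toℚᵘ-/ x (suc n) = ℚ.toℚᵘ-fromℚᵘ (mkℚᵘ x n)

  mkℚᵘ-+ : ∀ a b d → mkℚᵘ a d ℚᵘ.+ mkℚᵘ b d ≃ᵘ mkℚᵘ (a + b) d
  mkℚᵘ-+ a b d = *≡* (trans (regroup a b (+ suc d)) (cong ((a + b) *_) (sym (ℤ.pos-* (suc d) (suc d)))))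
    where
    regroup : ∀ a b D → (a * D + b * D) * D ≡ (a + b) * (D * D)
    regroup = solve-∀

  toℚᵘ-subsetSum : ∀ {k} (I : Subset k) (f : Fin k → ℚ) (X : Fin k → ℤ) d →
    (∀ s → toℚᵘ (f s) ≃ᵘ mkℚᵘ (X s) d) → toℚᵘ (subsetSum I f) ≃ᵘ mkℚᵘ (subsetSumℤ I X) d
  toℚᵘ-subsetSum [] f X d f≃X = *≡* refl
  toℚᵘ-subsetSum (outside ∷ I) f X d f≃X = begin
    toℚᵘ (subsetSum (outside ∷ I) f)    ≈⟨ ℚ.toℚᵘ-cong (trans (subsetSum-∷ outside I f) (ℚ.+-identityˡ _)) ⟩
    toℚᵘ (subsetSum I (f ∘ suc))        ≈⟨ toℚᵘ-subsetSum I (f ∘ suc) (X ∘ suc) d (f≃X ∘ suc) ⟩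
    mkℚᵘ (subsetSumℤ I (X ∘ suc)) d     ∎
    where open ℚᵘ.≃-Reasoning
  toℚᵘ-subsetSum (inside ∷ I) f X d f≃X = begin
    toℚᵘ (subsetSum (inside ∷ I) f)
      ≈⟨ ℚ.toℚᵘ-cong (subsetSum-∷ inside I f) ⟩
    toℚᵘ (f zero ℚ.+ subsetSum I (f ∘ suc))
      ≈⟨ ℚ.toℚᵘ-homo-+ (f zero) (subsetSum I (f ∘ suc)) ⟩
    toℚᵘ (f zero) ℚᵘ.+ toℚᵘ (subsetSum I (f ∘ suc))
      ≈⟨ ℚᵘ.+-cong (f≃X zero) (toℚᵘ-subsetSum I (f ∘ suc) (X ∘ suc) d (f≃X ∘ suc)) ⟩
    mkℚᵘ (X zero) d ℚᵘ.+ mkℚᵘ (subsetSumℤ I (X ∘ suc)) d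
      ≈⟨ mkℚᵘ-+ (X zero) (subsetSumℤ I (X ∘ suc)) d ⟩
    mkℚᵘ (X zero + subsetSumℤ I (X ∘ suc)) d ∎
    where open ℚᵘ.≃-Reasoning

  toℚᵘ-− : ∀ {p q} a b d → toℚᵘ p ≃ᵘ mkℚᵘ a d → toℚᵘ q ≃ᵘ mkℚᵘ b d → toℚᵘ (p ℚ.- q) ≃ᵘ mkℚᵘ (a - b) d
  toℚᵘ-− {p} {q} a b d p≃a q≃b = begin
    toℚᵘ (p ℚ.- q)                      ≈⟨ ℚ.toℚᵘ-homo-+ p (ℚ.- q) ⟩
    toℚᵘ p ℚᵘ.+ toℚᵘ (ℚ.- q)            ≈⟨ ℚᵘ.+-cong p≃a (ℚᵘ.≃-trans (ℚ.toℚᵘ-homo‿- q) (ℚᵘ.-‿cong q≃b)) ⟩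
    mkℚᵘ a d ℚᵘ.+ mkℚᵘ (- b) d          ≈⟨ mkℚᵘ-+ a (- b) d ⟩
    mkℚᵘ (a - b) d                      ∎
    where open ℚᵘ.≃-Reasoning

  ≃m*z⇒≡m*z : ∀ m {q} z d → toℚᵘ q ≃ᵘ mkℚᵘ (z * + (m ℕ.* suc d)) d →
    q ≡ (+ m ℚ./ 1) ℚ.* (z ℚ./ 1)
  ≃m*z⇒≡m*z m {q} z d q≃mz = ℚ.toℚᵘ-injective (begin
    toℚᵘ q                                    ≈⟨ q≃mz ⟩
    mkℚᵘ (z * + (m ℕ.* suc d)) d              ≈⟨ *≡* (cancel z (+ m) (+ suc d) (ℤ.pos-* m (suc d))) ⟩
    mkℚᵘ (+ m * z) 0                          ≈⟨ ℚᵘ.*-cong (toℚᵘ-/ (+ m) 1) (toℚᵘ-/ z 1) ⟨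
    toℚᵘ (+ m ℚ./ 1) ℚᵘ.* toℚᵘ (z ℚ./ 1)      ≈⟨ ℚ.toℚᵘ-homo-* (+ m ℚ./ 1) (z ℚ./ 1) ⟨
    toℚᵘ ((+ m ℚ./ 1) ℚ.* (z ℚ./ 1))          ∎)
    where
    open ℚᵘ.≃-Reasoning
    regroup : ∀ z m D → z * (m * D) * + 1 ≡ m * z * D
    regroup = solve-∀
    cancel : ∀ z m D {mD} → mD ≡ m * D → z * mD * + 1 ≡ m * z * D
    cancel z m D refl = regroup z m D

  module _ {k} (n : Fin k → ℕ) (nz : ∀ s → NonZero (n s)) where

    private
      d : ℕ
      d = pred (∏ n)
      1+d≡∏ : suc d ≡ ∏ n
      1+d≡∏ = ℕ.suc-pred (∏ n) {{∏-nonZero n nz}}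

    toℚᵘ-/≃cofactor : ∀ x s → toℚᵘ ((x ℚ./ n s) {{nz s}}) ≃ᵘ mkℚᵘ (x * + cofactor n s) d
    toℚᵘ-/≃cofactor x s = ℚᵘ.≃-trans (toℚᵘ-/ x (n s) {{nz s}}) (*≡* (begin
      x * + suc d                              ≡⟨ cong (λ D → x * + D) (trans 1+d≡∏ (sym (n*cofactor≡∏ n s))) ⟩
      x * + (n s ℕ.* cofactor n s)             ≡⟨ cong (x *_) (ℤ.pos-* (n s) (cofactor n s)) ⟩
      x * (+ n s * + cofactor n s)             ≡⟨ regroup x (+ n s) (+ cofactor n s) ⟩
      x * + cofactor n s * + n s               ≡⟨ cong (λ D → x * + cofactor n s * + D) 1+pred[n]≡n ⟨
      x * + cofactor n s * + suc (pred (n s))  ∎))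
      where
      open ≡-Reasoning
      1+pred[n]≡n : suc (pred (n s)) ≡ n s
      1+pred[n]≡n = ℕ.suc-pred (n s) {{nz s}}
      regroup : ∀ x a b → x * (a * b) ≡ x * b * a
      regroup = solve-∀

    toℚᵘ-subsetSum-/ : ∀ I (x : Fin k → ℤ) →
      toℚᵘ (subsetSum I (λ s → (x s ℚ./ n s) {{nz s}})) ≃ᵘ mkℚᵘ (subsetSumℤ I (λ s → x s * + cofactor n s)) d
    toℚᵘ-subsetSum-/ I x = toℚᵘ-subsetSum I _ (λ s → x s * + cofactor n s) d (λ s → toℚᵘ-/≃cofactor (x s) s)

    private
      mkℚᵘ-multiple : ∀ m {S} z → S ≡ z * + (m ℕ.* ∏ n) → mkℚᵘ S d ≃ᵘ mkℚᵘ (z * + (m ℕ.* suc d)) d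
      mkℚᵘ-multiple m z S≡zM =
        ℚᵘ.≃-reflexive (cong (λ S → mkℚᵘ S d) (trans S≡zM (cong (λ D → z * + (m ℕ.* D)) (sym 1+d≡∏))))

    subsetSum-/≡multiple : ∀ m I (x : Fin k → ℤ) z →
      subsetSumℤ I (λ s → x s * + cofactor n s) ≡ z * + (m ℕ.* ∏ n) →
      subsetSum I (λ s → (x s ℚ./ n s) {{nz s}}) ≡ (+ m ℚ./ 1) ℚ.* (z ℚ./ 1)
    subsetSum-/≡multiple m I x z S≡zM =
      ≃m*z⇒≡m*z m z d (ℚᵘ.≃-trans (toℚᵘ-subsetSum-/ I x) (mkℚᵘ-multiple m z S≡zM))

    subsetSum-/-difference≡multiple : ∀ m I J (x : Fin k → ℤ) z →
      subsetSumℤ I (λ s → x s * + cofactor n s) - subsetSumℤ J (λ s → x s * + cofactor n s)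
        ≡ z * + (m ℕ.* ∏ n) →
      subsetSum I (λ s → (x s ℚ./ n s) {{nz s}}) ℚ.- subsetSum J (λ s → (x s ℚ./ n s) {{nz s}})
        ≡ (+ m ℚ./ 1) ℚ.* (z ℚ./ 1)
    subsetSum-/-difference≡multiple m I J x z S≡zM =
      ≃m*z⇒≡m*z m z d
        (ℚᵘ.≃-trans (toℚᵘ-− _ _ d (toℚᵘ-subsetSum-/ I x) (toℚᵘ-subsetSum-/ J x)) (mkℚᵘ-multiple m z S≡zM))

module ZeroSumConsequences where

  open import Data.Nat as ℕ using (_*_; _≤_; NonZero)
  import Data.Nat.Properties as ℕ
  open import Data.Nat.Divisibility using (_∣_; divides)
  open import Data.Integer as ℤ using (ℤ; +_; -_; _%ℕ_; _/ℕ_)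
  import Data.Integer.Properties as ℤ
  import Data.Integer.Divisibility.Signed as ℤ
  open import Data.Integer.DivMod using (a≡a%ℕn+[a/ℕn]*n)
  open import Data.Integer.Tactic.RingSolver using (solve-∀)
  import Data.Rational as ℚ
  open import Data.Fin using (Fin)
  open import Data.Fin.Subset using (Subset; Nonempty)
  open import Data.Vec using (lookup)
  open import Data.Bool using (true; false; if_then_else_)
  open import Data.Product using (∃; Σ; _×_; _,_)
  open import Relation.Nullary using (¬_)
  open import Relation.Binary.PropositionalEquality
  open ≡-Reasoning
  open SubsetSums
  open Covers using (∏; cofactor; n*cofactor≡∏; cofactor-nonZero)
  open Rationals using (subsetSum-/≡multiple; subsetSum-/-difference≡multiple)

  module _ {k} (n : Fin k → ℕ) (nz : ∀ s → NonZero (n s)) (m : ℕ) {{m≢0 : NonZero m}}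
    (zeroSum : ∀ (w : Fin k → ℕ) → ∃ λ I → Nonempty I × m * ∏ n ∣ subsetSumℕ I (λ s → w s * cofactor n s)) where

    private
      M : ℕ
      M = m * ∏ n

      instance
        m*n≢0 : ∀ {s} → NonZero (m * n s)
        m*n≢0 {s} = ℕ.m*n≢0 m (n s) {{m≢0}} {{nz s}}

      residue : (Fin k → ℤ) → Fin k → ℕ
      residue x s = x s %ℕ (m * n s)

      ≡residue-mod-M : ∀ (x : Fin k → ℤ) s →
        + M ℤ.∣ x s ℤ.* + cofactor n s ℤ.- + (residue x s * cofactor n s)
      ≡residue-mod-M x s = ℤ.divides q (begin
        x s ℤ.* + c ℤ.- + (residue x s * c)
          ≡⟨ cong₂ (λ y z → y ℤ.* + c ℤ.- z) (a≡a%ℕn+[a/ℕn]*n (x s) (m * n s)) (ℤ.pos-* (residue x s) c) ⟩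
        (+ residue x s ℤ.+ q ℤ.* + (m * n s)) ℤ.* + c ℤ.- + residue x s ℤ.* + c
          ≡⟨ regroup (+ residue x s) q (+ (m * n s)) (+ c) ⟩
        q ℤ.* (+ (m * n s) ℤ.* + c)
          ≡⟨ cong (q ℤ.*_) (trans (sym (ℤ.pos-* (m * n s) c)) (cong +_ m*n*c≡M)) ⟩
        q ℤ.* + M ∎)
        where
        c : ℕ
        c = cofactor n s
        q : ℤ
        q = x s /ℕ (m * n s)
        m*n*c≡M : m * n s * c ≡ M
        m*n*c≡M = trans (ℕ.*-assoc m (n s) c) (cong (m *_) (n*cofactor≡∏ n s))
        regroup : ∀ w q a c → (w ℤ.+ q ℤ.* a) ℤ.* c ℤ.- w ℤ.* c ≡ q ℤ.* (a ℤ.* c)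
        regroup = solve-∀

    integerZeroSum : ∀ (x : Fin k → ℤ) →
      ∃ λ I → Nonempty I × + M ℤ.∣ subsetSumℤ I (λ s → x s ℤ.* + cofactor n s)
    integerZeroSum x with zeroSum (residue x)
    ... | I , I≢∅ , M∣ρ = I , I≢∅ , subst (+ M ℤ.∣_) (cancel (subsetSumℤ I X) (subsetSumℤ I R))
          (ℤ.∣m∣n⇒∣m+n (∣-subsetSumℤ I X R (≡residue-mod-M x))
                       (subst (+ M ℤ.∣_) (sym (subsetSumℤ-pos I R′)) (ℤ.∣ᵤ⇒∣ M∣ρ)))
      where
      R′ : Fin k → ℕ
      R′ s = residue x s * cofactor n s
      X R : Fin k → ℤ
      X s = x s ℤ.* + cofactor n s
      R s = + R′ s
      cancel : ∀ a b → a ℤ.- b ℤ.+ b ≡ a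
      cancel = solve-∀

    nonemptyMultiple : ∀ (x : Fin k → ℤ) → Σ (Subset k) λ I → Nonempty I ×
      InMultiples m (subsetSum I (λ s → (x s ℚ./ n s) {{nz s}}))
    nonemptyMultiple x with integerZeroSum x
    ... | I , I≢∅ , ℤ.divides z S≡zM = I , I≢∅ , z , subsetSum-/≡multiple n nz m I x z S≡zM

    positiveMultiple : Σ (Subset k) λ I → InPosMultiples m (subsetSum I (λ s → (+ 1 ℚ./ n s) {{nz s}}))
    positiveMultiple with zeroSum (λ _ → 1)
    ... | I , I≢∅ , divides z ρ≡zM = I , z , 1≤z , subsetSum-/≡multiple n nz m I (λ _ → + 1) (+ z) S≡zM
      where
      r : Fin k → ℕ
      r s = 1 * cofactor n s
      1≤r : ∀ s → 1 ≤ r s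
      1≤r s = subst (1 ≤_) (sym (ℕ.*-identityˡ _)) (ℕ.>-nonZero⁻¹ (cofactor n s) {{cofactor-nonZero n nz s}})
      1≤z : 1 ≤ z
      1≤z = ℕ.n≢0⇒n>0 λ z≡0 →
        ℕ.<⇒≱ (subsetSumℕ-positive I r I≢∅ 1≤r) (ℕ.≤-reflexive (trans ρ≡zM (cong (_* M) z≡0)))
      S≡zM : subsetSumℤ I (λ s → + 1 ℤ.* + cofactor n s) ≡ + z ℤ.* + M
      S≡zM = begin
        subsetSumℤ I (λ s → + 1 ℤ.* + cofactor n s)  ≡⟨ subsetSumℤ-cong I (λ s → ℤ.*-identityˡ _) ⟩
        subsetSumℤ I (λ s → + cofactor n s)          ≡⟨ subsetSumℤ-cong I (λ s → cong +_ (sym (ℕ.*-identityˡ _))) ⟩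
        subsetSumℤ I (λ s → + r s)                   ≡⟨ subsetSumℤ-pos I r ⟩
        + subsetSumℕ I r                             ≡⟨ cong +_ ρ≡zM ⟩
        + (z * M)                                    ≡⟨ ℤ.pos-* z M ⟩
        + z ℤ.* + M                                  ∎

    multipleDifference : ∀ (x : Fin k → ℤ) (J : Subset k) → Σ (Subset k) λ I → ¬ (I ≡ J) ×
      InMultiples m (subsetSum I (λ s → (x s ℚ./ n s) {{nz s}}) ℚ.- subsetSum J (λ s → (x s ℚ./ n s) {{nz s}}))
    multipleDifference x J with integerZeroSum (λ s → if lookup J s then - x s else x s)
    ... | I , I≢∅ , ℤ.divides z S≡zM =
      I △ J , △-≢ I J I≢∅ , z , subsetSum-/-difference≡multiple n nz m (I △ J) J x z (begin
        subsetSumℤ (I △ J) X ℤ.- subsetSumℤ J X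
          ≡⟨ subsetSumℤ-△ I J X ⟩
        subsetSumℤ I (λ s → if lookup J s then - X s else X s)
          ≡⟨ subsetSumℤ-cong I sign-inside ⟩
        subsetSumℤ I (λ s → (if lookup J s then - x s else x s) ℤ.* + cofactor n s)
          ≡⟨ S≡zM ⟩
        z ℤ.* + M ∎)
      where
      X : Fin k → ℤ
      X s = x s ℤ.* + cofactor n s
      sign-inside : ∀ s →
        (if lookup J s then - X s else X s) ≡ (if lookup J s then - x s else x s) ℤ.* + cofactor n s
      sign-inside s with lookup J s
      ... | true = ℤ.neg-distribˡ-* (x s) (+ cofactor n s)
      ... | false = refl

open import Data.Nat using (NonZero)
import Data.Nat as ℕ
open import Data.Nat.Divisibility using (_∣_)
open import Data.Integer using (ℤ; +_)
open import Data.Rational using (ℚ; _/_; _-_)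
open import Data.Fin using (Fin)
open import Data.Fin.Subset using (Subset; Nonempty)
open import Data.Product using (Σ; _×_; _,_)
open import Data.Empty using (⊥-elim)
open import Relation.Nullary using (¬_)
open import Relation.Binary.PropositionalEquality using (sym)
open PrimePowerBinomials using (p^e≢0)
open Covers using (∏; cofactor; cover-zeroSum)
open SubsetSums using (subsetSumℕ)
open ZeroSumConsequences using (nonemptyMultiple; positiveMultiple; multipleDifference)

corollary2p2 : (m : ℕ) → IsPrimePower m →
    (k : ℕ) (a : Fin k → ℤ) (n : Fin k → ℕ) (nz : ∀ s → NonZero (n s)) →
    IsCover m k a n →
    (ms : Fin k → ℤ) →
    (Σ (Subset k) λ I → Nonempty I ×
        InMultiples m (subsetSum I (λ s → _/_ (ms s) (n s) {{nz s}})))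
    × (Σ (Subset k) λ I →
        InPosMultiples m (subsetSum I (λ s → _/_ (+ 1) (n s) {{nz s}})))
    × (∀ (J : Subset k) → Σ (Subset k) λ I → ¬ (I ≡ J) ×
        InMultiples m (subsetSum I (λ s → _/_ (ms s) (n s) {{nz s}})
          - subsetSum J (λ s → _/_ (ms s) (n s) {{nz s}})))
corollary2p2 zero (p , e , p-prime , 0≡p^e) k a n nz cover ms = ⊥-elim (p^e≢0 p-prime e (sym 0≡p^e))
corollary2p2 (suc m′) (p , e , p-prime , m≡p^e) k a n nz cover ms =
    nonemptyMultiple n nz (suc m′) zeroSum ms
  , positiveMultiple n nz (suc m′) zeroSum
  , multipleDifference n nz (suc m′) zeroSum ms
  where
  zeroSum : ∀ w → Σ (Subset k) λ I → Nonempty I × suc m′ ℕ.* ∏ n ∣ subsetSumℕ I (λ s → w s ℕ.* cofactor n s)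
  zeroSum = cover-zeroSum {e = e} p-prime m′ m≡p^e a n nz cover
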